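{- Let $U$ be a consistent c.e. theory and $\mathcal X$ a set of sentences. The following are equivalent: (i) $U$ is effectively essentially hereditarily $\mathcal X$-creative; (ii) there is a partial computable function $\Psi$ such that for all $i,j$, if $\mathsf W_i$ is a theory (in the language of $U$) consistent with $U$ and $(\mathsf W_i)_{\mathfrak p}\cap\mathsf W_j=\emptyset$, then $\Psi(i,j)$ converges, $\Psi(i,j)\in\mathcal X$, and $\Psi(i,j)\notin(\mathsf W_i)_{\mathfrak p}\cup\mathsf W_j$.
   Context: $\mathsf W_0,\mathsf W_1,\dots$ is a standard enumeration of c.e. sets; sentences are identified with Gödel numbers; $T_{\mathfrak p}$ is the set of theorems of $T$. $U$ is effectively essentially hereditarily $\mathcal X$-creative iff there is a partial computable $\Phi$ such that for all $i,j,k$: if $\mathsf W_k$ is a consistent extension of $U$ (in the same language), $\mathsf W_i$ is a subtheory of $\mathsf W_k$ (in the same language; every element of $\mathsf W_i$ is a theorem of $\mathsf W_k$), and $(\mathsf W_i)_{\mathfrak p}\cap\mathsf W_j=\emptyset$, then $\Phi(i,j,k)$ converges, $\Phi(i,j,k)\in\mathcal X$, and $\Phi(i,j,k)\notin(\mathsf W_i)_{\mathfrak p}\cup\mathsf W_j$. -}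

module Defs where

open import Data.Nat using (ℕ; zero; suc; _+_; _<_)
open import Data.Product using (Σ; ∃; _×_; _,_)
open import Data.Sum using (_⊎_)
open import Data.Empty using (⊥)
open import Relation.Nullary using (¬_)
open import Relation.Binary.PropositionalEquality using (_≡_)

-- Cantor pairing  ⟨a , b⟩ = (a+b)(a+b+1)/2 + b

tri : ℕ → ℕ
tri zero    = zero
tri (suc n) = suc n + tri n

pair : ℕ → ℕ → ℕ
pair a b = tri (a + b) + b

-- Partial recursive functions (unary, with pairing as data structure)

data Code : Set where
  Z S I P₁ P₂ : Code
  comp   : Code → Code → Code
  pr     : Code → Code → Code
  rec    : Code → Code → Code
  mu     : Code → Code

data _∙_⇓_ : Code → ℕ → ℕ → Set where
  zeroE : ∀ {x} → Z ∙ x ⇓ 0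
  succE : ∀ {x} → S ∙ x ⇓ suc x
  idE   : ∀ {x} → I ∙ x ⇓ x
  fstE  : ∀ {a b} → P₁ ∙ pair a b ⇓ a
  sndE  : ∀ {a b} → P₂ ∙ pair a b ⇓ b
  compE : ∀ {f g x y z} → g ∙ x ⇓ y → f ∙ y ⇓ z → comp f g ∙ x ⇓ z
  prE   : ∀ {f g x y z} → f ∙ x ⇓ y → g ∙ x ⇓ z → pr f g ∙ x ⇓ pair y z
  recZ  : ∀ {f g x y} → f ∙ x ⇓ y → rec f g ∙ pair x 0 ⇓ y
  recS  : ∀ {f g x n y z} → rec f g ∙ pair x n ⇓ y →
          g ∙ pair x (pair n y) ⇓ z → rec f g ∙ pair x (suc n) ⇓ z
  muE   : ∀ {f x n} → f ∙ pair x n ⇓ 0 →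
          (∀ m → m < n → ∃ λ k → f ∙ pair x m ⇓ suc k) → mu f ∙ x ⇓ n

encode : Code → ℕ
encode Z          = pair 0 0
encode S          = pair 1 0
encode I          = pair 2 0
encode P₁         = pair 3 0
encode P₂         = pair 4 0
encode (comp f g) = pair 5 (pair (encode f) (encode g))
encode (pr f g)   = pair 6 (pair (encode f) (encode g))
encode (rec f g)  = pair 7 (pair (encode f) (encode g))
encode (mu f)     = pair 8 (encode f)

-- φ_e(x) ⇓ y   (numbers that encode no code give the empty function)
_⟪_⟫⇓_ : ℕ → ℕ → ℕ → Set
e ⟪ x ⟫⇓ y = Σ Code λ c → encode c ≡ e × c ∙ x ⇓ y

W : ℕ → ℕ → Set
W e x = ∃ λ y → e ⟪ x ⟫⇓ y

-- Logic: sentences of the language of U are identified with ℕ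
-- (bijective Gödel numbering); a theory is a set of sentences.

Pred : Set₁
Pred = ℕ → Set

_∪_ : Pred → Pred → Pred
(A ∪ B) x = A x ⊎ B x

-- an abstract deductive consequence relation (e.g. first-order provability)
record Logic : Set₁ where
  field
    _⊢_  : Pred → ℕ → Set
    ax   : ∀ {Γ φ} → Γ φ → Γ ⊢ φ
    cut  : ∀ {Γ Δ φ} → (∀ {ψ} → Δ ψ → Γ ⊢ ψ) → Δ ⊢ φ → Γ ⊢ φ

module _ (L : Logic) where
  open Logic L

  Thm : Pred → Pred
  Thm T φ = T ⊢ φ

  Consistent : Pred → Set
  Consistent T = ∃ λ φ → ¬ (T ⊢ φ)

  Extends : Pred → Pred → Set
  Extends T U = ∀ φ → U ⊢ φ → T ⊢ φ

  Subtheory : Pred → Pred → Set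
  Subtheory A T = ∀ φ → A φ → T ⊢ φ

  Disjoint : Pred → Pred → Set
  Disjoint A B = ∀ x → A x → B x → ⊥

  -- effectively essentially hereditarily X-creative (Φ = φ_e, Φ(i,j,k) = φ_e⟨i,⟨j,k⟩⟩)
  EffEssHerCreative : Pred → Pred → Set
  EffEssHerCreative U X = ∃ λ e → ∀ i j k →
    Consistent (W k) → Extends (W k) U → Subtheory (W i) (W k) →
    Disjoint (Thm (W i)) (W j) →
    ∃ λ v → e ⟪ pair i (pair j k) ⟫⇓ v × X v × ¬ Thm (W i) v × ¬ W j v

  -- condition (ii)  (Ψ = φ_e, Ψ(i,j) = φ_e⟨i,j⟩)
  ConditionII : Pred → Pred → Set
  ConditionII U X = ∃ λ e → ∀ i j →
    Consistent (U ∪ W i) →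
    Disjoint (Thm (W i)) (W j) →
    ∃ λ v → e ⟪ pair i j ⟫⇓ v × X v × ¬ Thm (W i) v × ¬ W j v

-- (ii) ⇒ (i): take Φ(i , j , k) = Ψ(i , j).  If W_k is a consistent extension of U proving every
-- axiom of W_i, then U ∪ W_i is consistent, because whatever it proves, W_k proves.
-- (i) ⇒ (ii): take Ψ(i , j) = Φ(i , j , k(i)) with W_k(i) = W_u ∪ W_i, a theory with the same
-- theorems as U ∪ W_i.
--
-- The only real work is the computability of k, i.e. that the union of two c.e. sets is c.e.
-- uniformly in their indices.  With μ-recursive codes this requires running both computations
-- side by side, which is done by searching for a certificate: a finite list of evaluation facts,
-- each justified by others in the list through one rule of the big-step semantics.  Checking a
-- certificate is primitive recursive; valid certificates are sound (by well-founded induction on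
-- code numbers and inputs) and every evaluation has one (by induction on the derivation).

module Submission where

open import Defs
open import Data.Nat
open import Data.Nat.Properties
open import Data.Nat.Induction using (<-wellFounded)
open import Induction.WellFounded using (Acc; acc; WfRec)
open import Data.Product using (Σ; ∃; ∃₂; _×_; _,_; proj₁; proj₂; uncurry)
open import Data.Sum using (_⊎_; inj₁; inj₂; [_,_]′; swap)
open import Data.Empty using (⊥-elim)
open import Data.Fin using (Fin; zero; suc; toℕ; fromℕ<)
open import Data.Fin.Properties using (toℕ<n; toℕ-fromℕ<)
open import Data.Vec using (Vec; []; _∷_; lookup)
open import Data.List using (List; []; _∷_; concatMap; tabulate)
open import Data.List.Membership.Propositional using (_∈_; find; lose)
open import Data.List.Membership.Propositional.Properties using (∈-concatMap⁺; ∈-concatMap⁻; ∈-tabulate⁺)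
open import Data.List.Relation.Unary.Any using (here; there)
open import Relation.Binary using (tri<; tri≈; tri>)
open import Relation.Binary.PropositionalEquality
open import Relation.Nullary using (¬_)

next : ℕ × ℕ → ℕ × ℕ
next (zero  , b) = suc b , 0
next (suc a , b) = a , suc b

unpair : ℕ → ℕ × ℕ
unpair zero    = 0 , 0
unpair (suc n) = next (unpair n)

π₁ π₂ : ℕ → ℕ
π₁ n = proj₁ (unpair n)
π₂ n = proj₂ (unpair n)

pair-next : ∀ p → uncurry pair (next p) ≡ suc (uncurry pair p)
pair-next (zero , b) rewrite +-identityʳ b =
  cong suc (trans (+-identityʳ (b + tri b)) (+-comm b (tri b)))
pair-next (suc a , b) rewrite +-suc a b = +-suc (tri (suc (a + b))) b

pair-π : ∀ n → pair (π₁ n) (π₂ n) ≡ n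
pair-π zero    = refl
pair-π (suc n) = trans (pair-next (unpair n)) (cong suc (pair-π n))

n≤tri : ∀ n → n ≤ tri n
n≤tri zero    = z≤n
n≤tri (suc n) = m≤m+n (suc n) (tri n)

tri-mono-≤ : ∀ {m n} → m ≤ n → tri m ≤ tri n
tri-mono-≤ {zero}          _         = z≤n
tri-mono-≤ {suc m} {suc n} (s≤s m≤n) = +-mono-≤ (s≤s m≤n) (tri-mono-≤ m≤n)

a+b≤pair : ∀ a b → a + b ≤ pair a b
a+b≤pair a b = ≤-trans (n≤tri (a + b)) (m≤m+n (tri (a + b)) b)

a≤pair : ∀ a b → a ≤ pair a b
a≤pair a b = ≤-trans (m≤m+n a b) (a+b≤pair a b)

b≤pair : ∀ a b → b ≤ pair a b
b≤pair a b = ≤-trans (m≤n+m b a) (a+b≤pair a b)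

b<pair-suc : ∀ a b → b < pair (suc a) b
b<pair-suc a b = ≤-trans (s≤s (m≤n+m b a)) (a+b≤pair (suc a) b)

pair<pair-suc : ∀ a b → pair a b < pair a (suc b)
pair<pair-suc a b = +-mono-≤-< (tri-mono-≤ (+-monoʳ-≤ a (n≤1+n b))) (n<1+n b)

unpair-pair : ∀ a b → unpair (pair a b) ≡ (a , b)
unpair-pair a b = go (pair a b) (a , b) refl
  where
  go : ∀ n p → uncurry pair p ≡ n → unpair n ≡ p
  go zero    (zero  , zero)  _  = refl
  go zero    (zero  , suc b) ()
  go zero    (suc a , b)     ()
  go (suc n) (zero  , zero)  ()
  go (suc n) (a     , suc b) eq =
    cong next (go n (suc a , b) (suc-injective (trans (sym (pair-next (suc a , b))) eq)))
  go (suc n) (suc a , zero)  eq =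
    cong next (go n (zero , a) (suc-injective (trans (sym (pair-next (zero , a))) eq)))

π₁-pair : ∀ a b → π₁ (pair a b) ≡ a
π₁-pair a b = cong proj₁ (unpair-pair a b)

π₂-pair : ∀ a b → π₂ (pair a b) ≡ b
π₂-pair a b = cong proj₂ (unpair-pair a b)

pair-injective : ∀ {a b c d} → pair a b ≡ pair c d → a ≡ c × b ≡ d
pair-injective {a} {b} {c} {d} eq =
  trans (sym (π₁-pair a b)) (trans (cong π₁ eq) (π₁-pair c d)) ,
  trans (sym (π₂-pair a b)) (trans (cong π₂ eq) (π₂-pair c d))

π₁≤ : ∀ n → π₁ n ≤ n
π₁≤ n = subst (π₁ n ≤_) (pair-π n) (a≤pair (π₁ n) (π₂ n))

π₂≤ : ∀ n → π₂ n ≤ n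
π₂≤ n = subst (π₂ n ≤_) (pair-π n) (b≤pair (π₁ n) (π₂ n))

π₁<pair-suc : ∀ a b → π₁ b < pair (suc a) b
π₁<pair-suc a b = ≤-<-trans (π₁≤ b) (b<pair-suc a b)

π₂<pair-suc : ∀ a b → π₂ b < pair (suc a) b
π₂<pair-suc a b = ≤-<-trans (π₂≤ b) (b<pair-suc a b)

P₁-inverse : ∀ {a b y} → P₁ ∙ pair a b ⇓ y → y ≡ a
P₁-inverse {a} {b} d = go {a = a} {b} d refl
  where
  go : ∀ {x a b y} → P₁ ∙ x ⇓ y → x ≡ pair a b → y ≡ a
  go {a = a} {b} (fstE {a′} {b′}) eq = proj₁ (pair-injective {a′} {b′} {a} {b} eq)

P₂-inverse : ∀ {a b y} → P₂ ∙ pair a b ⇓ y → y ≡ b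
P₂-inverse {a} {b} d = go {a = a} {b} d refl
  where
  go : ∀ {x a b y} → P₂ ∙ x ⇓ y → x ≡ pair a b → y ≡ b
  go {a = a} {b} (sndE {a′} {b′}) eq = proj₂ (pair-injective {a′} {b′} {a} {b} eq)

P₁-⇓ : ∀ x → P₁ ∙ x ⇓ π₁ x
P₁-⇓ x = subst (P₁ ∙_⇓ π₁ x) (pair-π x) (fstE {π₁ x} {π₂ x})

P₂-⇓ : ∀ x → P₂ ∙ x ⇓ π₂ x
P₂-⇓ x = subst (P₂ ∙_⇓ π₂ x) (pair-π x) (sndE {π₁ x} {π₂ x})

rec-inverse : ∀ {f g x n y} → rec f g ∙ pair x n ⇓ y →
  (n ≡ 0 × f ∙ x ⇓ y) ⊎
  (∃₂ λ m y′ → n ≡ suc m × rec f g ∙ pair x m ⇓ y′ × g ∙ pair x (pair m y′) ⇓ y)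
rec-inverse {x = x} {n} d = go {x = x} {n} d refl
  where
  go : ∀ {f g z x n y} → rec f g ∙ z ⇓ y → z ≡ pair x n →
    (n ≡ 0 × f ∙ x ⇓ y) ⊎
    (∃₂ λ m y′ → n ≡ suc m × rec f g ∙ pair x m ⇓ y′ × g ∙ pair x (pair m y′) ⇓ y)
  go {x = a} {m} (recZ {x = x} d) eq with pair-injective {x} {0} {a} {m} eq
  ... | refl , refl = inj₁ (refl , d)
  go {x = a} {m} (recS {x = x} {n} d₁ d₂) eq with pair-injective {x} {suc n} {a} {m} eq
  ... | refl , refl = inj₂ (_ , _ , refl , d₁ , d₂)

⇓-deterministic : ∀ {c x y y′} → c ∙ x ⇓ y → c ∙ x ⇓ y′ → y ≡ y′
⇓-deterministic zeroE zeroE = refl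
⇓-deterministic succE succE = refl
⇓-deterministic idE   idE   = refl
⇓-deterministic (fstE {a} {b}) d′ = sym (P₁-inverse {a} {b} d′)
⇓-deterministic (sndE {a} {b}) d′ = sym (P₂-inverse {a} {b} d′)
⇓-deterministic (compE d₁ d₂) (compE d₁′ d₂′) with ⇓-deterministic d₁ d₁′
... | refl = ⇓-deterministic d₂ d₂′
⇓-deterministic (prE d₁ d₂) (prE d₁′ d₂′) =
  cong₂ pair (⇓-deterministic d₁ d₁′) (⇓-deterministic d₂ d₂′)
⇓-deterministic (recZ {x = x} d) d′ with rec-inverse {x = x} {0} d′
... | inj₁ (_ , d″)            = ⇓-deterministic d d″
... | inj₂ (_ , _ , () , _)
⇓-deterministic (recS {x = x} {n} d₁ d₂) d′ with rec-inverse {x = x} {suc n} d′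
... | inj₁ (() , _)
... | inj₂ (_ , _ , refl , d₁′ , d₂′) with ⇓-deterministic d₁ d₁′
... | refl = ⇓-deterministic d₂ d₂′
⇓-deterministic (muE {n = n} d h) (muE {n = n′} d′ h′) with <-cmp n n′
... | tri≈ _ eq _ = eq
... | tri< n<n′ _ _ = ⊥-elim (0≢1+n (⇓-deterministic d (proj₂ (h′ n n<n′))))
... | tri> _ _ n′<n = ⊥-elim (1+n≢0 (⇓-deterministic (proj₂ (h n′ n′<n)) d′))

tag : Code → ℕ
tag Z          = 0
tag S          = 1
tag I          = 2
tag P₁         = 3
tag P₂         = 4
tag (comp _ _) = 5
tag (pr _ _)   = 6
tag (rec _ _)  = 7
tag (mu _)     = 8

π₁-encode : ∀ c → π₁ (encode c) ≡ tag c
π₁-encode Z          = refl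
π₁-encode S          = π₁-pair 1 0
π₁-encode I          = π₁-pair 2 0
π₁-encode P₁         = π₁-pair 3 0
π₁-encode P₂         = π₁-pair 4 0
π₁-encode (comp f g) = π₁-pair 5 (pair (encode f) (encode g))
π₁-encode (pr f g)   = π₁-pair 6 (pair (encode f) (encode g))
π₁-encode (rec f g)  = π₁-pair 7 (pair (encode f) (encode g))
π₁-encode (mu f)     = π₁-pair 8 (encode f)

size : Code → ℕ
size (comp f g) = suc (size f + size g)
size (pr f g)   = suc (size f + size g)
size (rec f g)  = suc (size f + size g)
size (mu f)     = suc (size f)
size _          = 0

decodeWith : ℕ → ℕ → Code
decodeWith zero    _ = Z
decodeWith (suc k) n = node (π₁ n) (π₂ n)
  where
  node : ℕ → ℕ → Code
  node 1 _ = S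
  node 2 _ = I
  node 3 _ = P₁
  node 4 _ = P₂
  node 5 p = comp (decodeWith k (π₁ p)) (decodeWith k (π₂ p))
  node 6 p = pr   (decodeWith k (π₁ p)) (decodeWith k (π₂ p))
  node 7 p = rec  (decodeWith k (π₁ p)) (decodeWith k (π₂ p))
  node 8 p = mu   (decodeWith k p)
  node _ _ = Z

decodeWith-encode : ∀ c {k} → size c ≤ k → decodeWith (suc k) (encode c) ≡ c
decodeWith-encode Z  _ = refl
decodeWith-encode S  _ = refl
decodeWith-encode I  _ = refl
decodeWith-encode P₁ _ = refl
decodeWith-encode P₂ _ = refl
decodeWith-encode (comp f g) {suc k} (s≤s le)
  rewrite π₁-pair 5 (pair (encode f) (encode g)) | π₂-pair 5 (pair (encode f) (encode g))
        | π₁-pair (encode f) (encode g) | π₂-pair (encode f) (encode g) =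
  cong₂ comp (decodeWith-encode f (m+n≤o⇒m≤o _ le)) (decodeWith-encode g (m+n≤o⇒n≤o _ le))
decodeWith-encode (pr f g) {suc k} (s≤s le)
  rewrite π₁-pair 6 (pair (encode f) (encode g)) | π₂-pair 6 (pair (encode f) (encode g))
        | π₁-pair (encode f) (encode g) | π₂-pair (encode f) (encode g) =
  cong₂ pr (decodeWith-encode f (m+n≤o⇒m≤o _ le)) (decodeWith-encode g (m+n≤o⇒n≤o _ le))
decodeWith-encode (rec f g) {suc k} (s≤s le)
  rewrite π₁-pair 7 (pair (encode f) (encode g)) | π₂-pair 7 (pair (encode f) (encode g))
        | π₁-pair (encode f) (encode g) | π₂-pair (encode f) (encode g) =
  cong₂ rec (decodeWith-encode f (m+n≤o⇒m≤o _ le)) (decodeWith-encode g (m+n≤o⇒n≤o _ le))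
decodeWith-encode (mu f) {suc k} (s≤s le)
  rewrite π₁-pair 8 (encode f) | π₂-pair 8 (encode f) =
  cong mu (decodeWith-encode f le)

encode-injective : ∀ c d → encode c ≡ encode d → c ≡ d
encode-injective c d eq = begin
  c                      ≡⟨ sym (decodeWith-encode c (m≤m+n (size c) (size d))) ⟩
  decodeWith k (encode c) ≡⟨ cong (decodeWith k) eq ⟩
  decodeWith k (encode d) ≡⟨ decodeWith-encode d (m≤n+m (size d) (size c)) ⟩
  d                      ∎
  where
  open ≡-Reasoning
  k = suc (size c + size d)

encode-rec-inverse : ∀ c {r} → encode c ≡ pair 7 r →
  ∃₂ λ f g → c ≡ rec f g × encode f ≡ π₁ r × encode g ≡ π₂ r
encode-rec-inverse c {r} eq =
  go c (trans (sym (π₁-encode c)) (trans (cong π₁ eq) (π₁-pair 7 r))) eq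
  where
  go : ∀ c → tag c ≡ 7 → encode c ≡ pair 7 r →
    ∃₂ λ f g → c ≡ rec f g × encode f ≡ π₁ r × encode g ≡ π₂ r
  go (rec f g) _ eq with proj₂ (pair-injective {7} {pair (encode f) (encode g)} {7} {r} eq)
  ... | refl = f , g , refl , sym (π₁-pair (encode f) (encode g)) , sym (π₂-pair (encode f) (encode g))
  go Z          ()
  go S          ()
  go I          ()
  go P₁         ()
  go P₂         ()
  go (comp _ _) ()
  go (pr _ _)   ()
  go (mu _)     ()

encode-node : ∀ t r f g → encode f ≡ π₁ r → encode g ≡ π₂ r → pair t (pair (encode f) (encode g)) ≡ pair t r
encode-node t r f g ef eg = cong (pair t) (trans (cong₂ pair ef eg) (pair-π r))

⟪⟫-code : ∀ {f c x y} → encode f ≡ c → c ⟪ x ⟫⇓ y → f ∙ x ⇓ y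
⟪⟫-code {f} ef (g , eg , d) = subst (λ h → h ∙ _ ⇓ _) (encode-injective g f (trans eg (sym ef))) d

⟪⟫-basic : ∀ t r {x y} (f : Code) → encode f ≡ pair t 0 → r ≡ 0 → f ∙ x ⇓ y → pair t r ⟪ x ⟫⇓ y
⟪⟫-basic t r f ef r≡0 d = f , trans ef (cong (pair t) (sym r≡0)) , d

⟪⟫-comp : ∀ r {x w y} → π₂ r ⟪ x ⟫⇓ w → π₁ r ⟪ w ⟫⇓ y → pair 5 r ⟪ x ⟫⇓ y
⟪⟫-comp r (g , eg , dg) (f , ef , df) = comp f g , encode-node 5 r f g ef eg , compE dg df

⟪⟫-pr : ∀ r {x y₁ y₂} → π₁ r ⟪ x ⟫⇓ y₁ → π₂ r ⟪ x ⟫⇓ y₂ → pair 6 r ⟪ x ⟫⇓ pair y₁ y₂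
⟪⟫-pr r (f , ef , df) (g , eg , dg) = pr f g , encode-node 6 r f g ef eg , prE df dg

⟪⟫-rec-zero : ∀ r {a y} → π₁ r ⟪ a ⟫⇓ y → (∃ λ g → encode g ≡ π₂ r) → pair 7 r ⟪ pair a 0 ⟫⇓ y
⟪⟫-rec-zero r (f , ef , df) (g , eg) = rec f g , encode-node 7 r f g ef eg , recZ df

⟪⟫-rec-suc : ∀ r {a n w y} → pair 7 r ⟪ pair a n ⟫⇓ w → π₂ r ⟪ pair a (pair n w) ⟫⇓ y →
  pair 7 r ⟪ pair a (suc n) ⟫⇓ y
⟪⟫-rec-suc r {a} {n} (c , ec , dc) (g′ , eg′ , dg′) with encode-rec-inverse c {r} ec
... | f , g , refl , _ , eg with encode-injective g g′ (trans eg (sym eg′))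
... | refl = rec f g , ec , recS {x = a} {n} dc dg′

⟪⟫-mu : ∀ r {x n} → r ⟪ pair x n ⟫⇓ 0 → (∀ m → m < n → ∃ λ k → r ⟪ pair x m ⟫⇓ suc k) → pair 8 r ⟪ x ⟫⇓ n
⟪⟫-mu r (f , ef , df) below =
  mu f , cong (pair 8) ef , muE df (λ m m<n → let k , d = below m m<n in k , ⟪⟫-code ef d)

-- Total computable functions of several arguments

encodeVec : ∀ {m} → Vec ℕ m → ℕ
encodeVec []       = 0
encodeVec (a ∷ xs) = pair a (encodeVec xs)

record Computable (m : ℕ) : Set where
  constructor computable
  field
    code     : Code
    fun      : Vec ℕ m → ℕ
    computes : ∀ xs → code ∙ encodeVec xs ⇓ fun xs
open Computable public

resp-≗ : ∀ {m} (F : Computable m) (g : Vec ℕ m → ℕ) → (∀ xs → fun F xs ≡ g xs) → Computable m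
resp-≗ F g eq = computable (code F) g (λ xs → subst (code F ∙ encodeVec xs ⇓_) (eq xs) (computes F xs))

const-code : ℕ → Code
const-code zero    = Z
const-code (suc k) = comp S (const-code k)

const-code-⇓ : ∀ k x → const-code k ∙ x ⇓ k
const-code-⇓ zero    x = zeroE
const-code-⇓ (suc k) x = compE (const-code-⇓ k x) succE

constant : ∀ {m} → ℕ → Computable m
constant k = computable (const-code k) (λ _ → k) (λ xs → const-code-⇓ k (encodeVec xs))

sucᶜ : Computable 1
sucᶜ = computable (comp S P₁) (λ { (a ∷ []) → suc a })
  (λ { (a ∷ []) → compE (fstE {a} {0}) succE })

π₁ᶜ : Computable 1
π₁ᶜ = computable (comp P₁ P₁) (λ { (a ∷ []) → π₁ a })
  (λ { (a ∷ []) → compE (fstE {a} {0}) (P₁-⇓ a) })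

π₂ᶜ : Computable 1
π₂ᶜ = computable (comp P₂ P₁) (λ { (a ∷ []) → π₂ a })
  (λ { (a ∷ []) → compE (fstE {a} {0}) (P₂-⇓ a) })

pairᶜ : Computable 2
pairᶜ = computable (pr P₁ (comp P₁ P₂)) (λ { (a ∷ b ∷ []) → pair a b })
  (λ { (a ∷ b ∷ []) → prE (fstE {a} {pair b 0}) (compE (sndE {a} {pair b 0}) (fstE {b} {0})) })

mutual
  data Term (n : ℕ) : Set where
    var  : Fin n → Term n
    call : ∀ {m} → Computable m → Terms n m → Term n

  data Terms (n : ℕ) : ℕ → Set where
    []  : Terms n 0
    _∷_ : ∀ {m} → Term n → Terms n m → Terms n (suc m)

mutual
  eval : ∀ {n} → Term n → Vec ℕ n → ℕ
  eval (var i)     ρ = lookup ρ i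
  eval (call F ts) ρ = fun F (eval* ts ρ)

  eval* : ∀ {n m} → Terms n m → Vec ℕ n → Vec ℕ m
  eval* []       ρ = []
  eval* (t ∷ ts) ρ = eval t ρ ∷ eval* ts ρ

proj-code : ∀ {n} → Fin n → Code
proj-code zero    = P₁
proj-code (suc i) = comp (proj-code i) P₂

proj-code-⇓ : ∀ {n} (i : Fin n) ρ → proj-code i ∙ encodeVec ρ ⇓ lookup ρ i
proj-code-⇓ zero    (a ∷ ρ) = fstE {a} {encodeVec ρ}
proj-code-⇓ (suc i) (a ∷ ρ) = compE (sndE {a} {encodeVec ρ}) (proj-code-⇓ i ρ)

mutual
  compile : ∀ {n} → Term n → Code
  compile (var i)     = proj-code i
  compile (call F ts) = comp (code F) (compile* ts)

  compile* : ∀ {n m} → Terms n m → Code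
  compile* []       = Z
  compile* (t ∷ ts) = pr (compile t) (compile* ts)

mutual
  compile-⇓ : ∀ {n} (t : Term n) ρ → compile t ∙ encodeVec ρ ⇓ eval t ρ
  compile-⇓ (var i)     ρ = proj-code-⇓ i ρ
  compile-⇓ (call F ts) ρ = compE (compile*-⇓ ts ρ) (computes F (eval* ts ρ))

  compile*-⇓ : ∀ {n m} (ts : Terms n m) ρ → compile* ts ∙ encodeVec ρ ⇓ encodeVec (eval* ts ρ)
  compile*-⇓ []       ρ = zeroE
  compile*-⇓ (t ∷ ts) ρ = prE (compile-⇓ t ρ) (compile*-⇓ ts ρ)

fromTerm : ∀ {n} → Term n → Computable n
fromTerm t = computable (compile t) (eval t) (compile-⇓ t)

lit : ∀ {n} → ℕ → Term n
lit k = call (constant k) []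

v₀ : ∀ {n} → Term (1 + n)
v₀ = var zero
v₁ : ∀ {n} → Term (2 + n)
v₁ = var (suc zero)
v₂ : ∀ {n} → Term (3 + n)
v₂ = var (suc (suc zero))
v₃ : ∀ {n} → Term (4 + n)
v₃ = var (suc (suc (suc zero)))
v₄ : ∀ {n} → Term (5 + n)
v₄ = var (suc (suc (suc (suc zero))))
v₅ : ∀ {n} → Term (6 + n)
v₅ = var (suc (suc (suc (suc (suc zero)))))

call₁ : ∀ {n} → Computable 1 → Term n → Term n
call₁ F a = call F (a ∷ [])

call₂ : ∀ {n} → Computable 2 → Term n → Term n → Term n
call₂ F a b = call F (a ∷ b ∷ [])

call₃ : ∀ {n} → Computable 3 → Term n → Term n → Term n → Term n
call₃ F a b c = call F (a ∷ b ∷ c ∷ [])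

natrec : ∀ {m} → (Vec ℕ m → ℕ) → (Vec ℕ (2 + m) → ℕ) → Vec ℕ (1 + m) → ℕ
natrec b s (zero  ∷ xs) = b xs
natrec b s (suc n ∷ xs) = s (n ∷ natrec b s (n ∷ xs) ∷ xs)

natrecᶜ : ∀ {m} → Computable m → Computable (2 + m) → Computable (1 + m)
natrecᶜ B St = computable (comp (rec (code B) step) (pr P₂ P₁)) (natrec (fun B) (fun St))
  (λ { (n ∷ xs) → compE (prE (sndE {n} {encodeVec xs}) (fstE {n} {encodeVec xs})) (rec-⇓ n xs) })
  where
  -- the step of rec receives ⟨xs , ⟨n , y⟩⟩, while St expects ⟨n , ⟨y , xs⟩⟩
  step : Code
  step = comp (code St) (pr (comp P₁ P₂) (pr (comp P₂ P₂) P₁))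

  rec-⇓ : ∀ n xs → rec (code B) step ∙ pair (encodeVec xs) n ⇓ natrec (fun B) (fun St) (n ∷ xs)
  rec-⇓ zero    xs = recZ (computes B xs)
  rec-⇓ (suc n) xs = recS {x = encodeVec xs} {n} (rec-⇓ n xs)
    (compE (prE (compE (sndE {encodeVec xs} {pair n y}) (fstE {n} {y}))
                (prE (compE (sndE {encodeVec xs} {pair n y}) (sndE {n} {y})) (fstE {encodeVec xs} {pair n y})))
           (computes St (n ∷ y ∷ xs)))
    where y = natrec (fun B) (fun St) (n ∷ xs)

-- Booleans coded as natural numbers, nonzero meaning true

data IsTrue : ℕ → Set where
  is-true : ∀ {n} → IsTrue (suc n)

isZero : ℕ → ℕ
isZero zero    = 1
isZero (suc _) = 0

ifNZ : ℕ → ℕ → ℕ → ℕ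
ifNZ zero    x y = y
ifNZ (suc _) x y = x

eqᵇ : ℕ → ℕ → ℕ
eqᵇ zero    zero    = 1
eqᵇ zero    (suc _) = 0
eqᵇ (suc _) zero    = 0
eqᵇ (suc a) (suc b) = eqᵇ a b

andᵇ : ℕ → ℕ → ℕ
andᵇ zero    b = 0
andᵇ (suc _) b = b

orᵇ : ℕ → ℕ → ℕ
orᵇ zero    b = b
orᵇ (suc _) b = 1

fold< : (ℕ → ℕ → ℕ) → ℕ → (ℕ → ℕ) → ℕ → ℕ
fold< o z p zero    = z
fold< o z p (suc n) = o (fold< o z p n) (p n)

any< all< : (ℕ → ℕ) → ℕ → ℕ
any< = fold< orᵇ 0
all< = fold< andᵇ 1

isZero-sound : ∀ a → IsTrue (isZero a) → a ≡ 0
isZero-sound zero _ = refl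

isZero-isZero : ∀ a → IsTrue (isZero (isZero a)) → IsTrue a
isZero-isZero (suc a) _ = is-true

isZero-false : ∀ a → isZero a ≡ 0 → IsTrue a
isZero-false (suc a) _ = is-true

isZero-true : ∀ {a} → IsTrue a → isZero a ≡ 0
isZero-true is-true = refl

IsTrue-isZero : ∀ {a} → IsTrue a → ¬ IsTrue (isZero a)
IsTrue-isZero is-true ()

eqᵇ-sound : ∀ a b → IsTrue (eqᵇ a b) → a ≡ b
eqᵇ-sound zero    zero    _ = refl
eqᵇ-sound (suc a) (suc b) t = cong suc (eqᵇ-sound a b t)

eqᵇ-complete : ∀ {a b} → a ≡ b → IsTrue (eqᵇ a b)
eqᵇ-complete {a} refl = go a
  where
  go : ∀ a → IsTrue (eqᵇ a a)
  go zero    = is-true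
  go (suc a) = go a

≢ᵇ-sound : ∀ a b → IsTrue (isZero (eqᵇ a b)) → ¬ a ≡ b
≢ᵇ-sound a b t refl = IsTrue-isZero (eqᵇ-complete {a} refl) t

andᵇ-elim : ∀ a b → IsTrue (andᵇ a b) → IsTrue a × IsTrue b
andᵇ-elim (suc a) b t = is-true , t

and₃ : ∀ a b c → IsTrue (andᵇ a (andᵇ b c)) → IsTrue a × IsTrue b × IsTrue c
and₃ (suc _) (suc _) c t = is-true , is-true , t

and₄ : ∀ a b c d → IsTrue (andᵇ a (andᵇ b (andᵇ c d))) → IsTrue a × IsTrue b × IsTrue c × IsTrue d
and₄ (suc _) (suc _) (suc _) d t = is-true , is-true , is-true , t

andᵇ-intro : ∀ {a b} → IsTrue a → IsTrue b → IsTrue (andᵇ a b)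
andᵇ-intro is-true t = t

orᵇ-elim : ∀ a b → IsTrue (orᵇ a b) → IsTrue a ⊎ IsTrue b
orᵇ-elim zero    b t = inj₂ t
orᵇ-elim (suc a) b t = inj₁ is-true

orᵇ-introˡ : ∀ {a} b → IsTrue a → IsTrue (orᵇ a b)
orᵇ-introˡ b is-true = is-true

orᵇ-introʳ : ∀ a {b} → IsTrue b → IsTrue (orᵇ a b)
orᵇ-introʳ zero    t = t
orᵇ-introʳ (suc a) t = is-true

any<-elim : ∀ p n → IsTrue (any< p n) → ∃ λ i → i < n × IsTrue (p i)
any<-elim p (suc n) t with orᵇ-elim (any< p n) (p n) t
... | inj₁ t′ = let (i , i<n , pi) = any<-elim p n t′ in i , m<n⇒m<1+n i<n , pi
... | inj₂ pn = n , n<1+n n , pn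

any<-intro : ∀ p n i → i < n → IsTrue (p i) → IsTrue (any< p n)
any<-intro p (suc n) i i<1+n pi with m<1+n⇒m<n∨m≡n i<1+n
... | inj₁ i<n  = orᵇ-introˡ (p n) (any<-intro p n i i<n pi)
... | inj₂ refl = orᵇ-introʳ (any< p n) pi

all<-elim : ∀ p n → IsTrue (all< p n) → ∀ i → i < n → IsTrue (p i)
all<-elim p (suc n) t i i<1+n with andᵇ-elim (all< p n) (p n) t | m<1+n⇒m<n∨m≡n i<1+n
... | t′ , _  | inj₁ i<n  = all<-elim p n t′ i i<n
... | _  , pn | inj₂ refl = pn

all<-intro : ∀ p n → (∀ i → i < n → IsTrue (p i)) → IsTrue (all< p n)
all<-intro p zero    h = is-true
all<-intro p (suc n) h = andᵇ-intro (all<-intro p n (λ i i<n → h i (m<n⇒m<1+n i<n))) (h n (n<1+n n))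

first-true : ∀ (p : ℕ → ℕ) n → (∀ k → k < n → p k ≡ 0) ⊎ (∃ λ m → m < n × IsTrue (p m) × ∀ k → k < m → p k ≡ 0)
first-true p zero = inj₁ (λ _ ())
first-true p (suc n) with first-true p n
... | inj₂ (m , m<n , pm , before) = inj₂ (m , m<n⇒m<1+n m<n , pm , before)
... | inj₁ before with p n in eq
... | suc _ = inj₂ (n , n<1+n n , subst IsTrue (sym eq) is-true , before)
... | zero  = inj₁ λ k k<1+n → [ before k , (λ { refl → eq }) ]′ (m<1+n⇒m<n∨m≡n k<1+n)

least-true : ∀ (p : ℕ → ℕ) n → IsTrue (p n) → ∃ λ m → IsTrue (p m) × ∀ k → k < m → p k ≡ 0
least-true p n pn with first-true p (suc n)
... | inj₂ (m , _ , pm , before) = m , pm , before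
... | inj₁ none with p n | none n (n<1+n n)
least-true p n () | inj₁ none | .0 | refl

predᶜ : Computable 1
predᶜ = resp-≗ (natrecᶜ (constant 0) (fromTerm v₀)) (λ { (a ∷ []) → pred a })
  (λ { (zero ∷ []) → refl ; (suc a ∷ []) → refl })

isZeroᶜ : Computable 1
isZeroᶜ = resp-≗ (natrecᶜ (constant 1) (fromTerm (lit 0))) (λ { (a ∷ []) → isZero a })
  (λ { (zero ∷ []) → refl ; (suc a ∷ []) → refl })

ifNZᶜ : Computable 3
ifNZᶜ = resp-≗ (natrecᶜ (fromTerm v₁) (fromTerm v₂)) (λ { (b ∷ x ∷ y ∷ []) → ifNZ b x y })
  (λ { (zero ∷ x ∷ y ∷ []) → refl ; (suc b ∷ x ∷ y ∷ []) → refl })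

∸ᶜ : Computable 2
∸ᶜ = resp-≗ (fromTerm (call₂ flipped v₁ v₀)) (λ { (a ∷ b ∷ []) → a ∸ b })
  (λ { (a ∷ b ∷ []) → sub-by-pred b a })
  where
  flipped : Computable 2
  flipped = natrecᶜ (fromTerm v₀) (fromTerm (call₁ predᶜ v₁))

  sub-by-pred : ∀ b a → fun flipped (b ∷ a ∷ []) ≡ a ∸ b
  sub-by-pred zero    a = refl
  sub-by-pred (suc b) a = trans (cong pred (sub-by-pred b a)) (pred[m∸n]≡m∸[1+n] a b)

eqᵇᶜ : Computable 2
eqᵇᶜ = resp-≗ (fromTerm (call₃ ifNZᶜ (call₁ isZeroᶜ (call₂ ∸ᶜ v₀ v₁)) (call₁ isZeroᶜ (call₂ ∸ᶜ v₁ v₀)) (lit 0)))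
  (λ { (a ∷ b ∷ []) → eqᵇ a b }) (λ { (a ∷ b ∷ []) → eqᵇ-by-∸ a b })
  where
  eqᵇ-by-∸ : ∀ a b → ifNZ (isZero (a ∸ b)) (isZero (b ∸ a)) 0 ≡ eqᵇ a b
  eqᵇ-by-∸ zero    zero    = refl
  eqᵇ-by-∸ zero    (suc b) = refl
  eqᵇ-by-∸ (suc a) zero    = refl
  eqᵇ-by-∸ (suc a) (suc b) = eqᵇ-by-∸ a b

andᵇᶜ : Computable 2
andᵇᶜ = resp-≗ (fromTerm (call₃ ifNZᶜ v₀ v₁ (lit 0))) (λ { (a ∷ b ∷ []) → andᵇ a b })
  (λ { (zero ∷ b ∷ []) → refl ; (suc a ∷ b ∷ []) → refl })

orᵇᶜ : Computable 2
orᵇᶜ = resp-≗ (fromTerm (call₃ ifNZᶜ v₀ (lit 1) v₁)) (λ { (a ∷ b ∷ []) → orᵇ a b })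
  (λ { (zero ∷ b ∷ []) → refl ; (suc a ∷ b ∷ []) → refl })

fold<ᶜ : ∀ {m} (O : Computable 2) → ℕ → (P : Computable (suc m)) → Computable (suc m)
fold<ᶜ {m} O z P = resp-≗ (natrecᶜ (constant z) step)
  (λ { (n ∷ ps) → fold< (λ a b → fun O (a ∷ b ∷ [])) z (λ i → fun P (i ∷ ps)) n })
  (λ { (n ∷ ps) → natrec-fold n ps })
  where
  step : Computable (2 + m)
  step = computable (comp (code O) (pr (comp P₁ P₂) (pr (comp (code P) (pr P₁ (comp P₂ P₂))) Z)))
    (λ { (i ∷ prev ∷ ps) → fun O (prev ∷ fun P (i ∷ ps) ∷ []) })
    (λ { (i ∷ prev ∷ ps) →
      compE (prE (compE (sndE {i} {pair prev (encodeVec ps)}) (fstE {prev} {encodeVec ps}))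
                 (prE (compE (prE (fstE {i} {pair prev (encodeVec ps)})
                                  (compE (sndE {i} {pair prev (encodeVec ps)}) (sndE {prev} {encodeVec ps})))
                             (computes P (i ∷ ps)))
                      zeroE))
            (computes O (prev ∷ fun P (i ∷ ps) ∷ [])) })

  natrec-fold : ∀ n ps → fun (natrecᶜ (constant z) step) (n ∷ ps)
    ≡ fold< (λ a b → fun O (a ∷ b ∷ [])) z (λ i → fun P (i ∷ ps)) n
  natrec-fold zero    ps = refl
  natrec-fold (suc n) ps = cong (λ q → fun O (q ∷ fun P (n ∷ ps) ∷ [])) (natrec-fold n ps)

any<ᶜ all<ᶜ : ∀ {m} → Computable (suc m) → Computable (suc m)
any<ᶜ P = resp-≗ (fold<ᶜ orᵇᶜ 0 P) (λ { (n ∷ ps) → any< (λ i → fun P (i ∷ ps)) n }) (λ { (n ∷ ps) → refl })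
all<ᶜ P = resp-≗ (fold<ᶜ andᵇᶜ 1 P) (λ { (n ∷ ps) → all< (λ i → fun P (i ∷ ps)) n }) (λ { (n ∷ ps) → refl })

encodeList : List ℕ → ℕ
encodeList []      = 0
encodeList (h ∷ t) = suc (pair h (encodeList t))

tailᴸ : ℕ → ℕ
tailᴸ zero    = 0
tailᴸ (suc m) = π₂ m

dropᴸ : ℕ → ℕ → ℕ
dropᴸ zero    L = L
dropᴸ (suc i) L = tailᴸ (dropᴸ i L)

infix 4 _∈ᴸ_
_∈ᴸ_ : ℕ → ℕ → Set
e ∈ᴸ L = ∃₂ λ i m → dropᴸ i L ≡ suc m × π₁ m ≡ e

dropᴸ-suc : ∀ i L → dropᴸ (suc i) L ≡ dropᴸ i (tailᴸ L)
dropᴸ-suc zero    L = refl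
dropᴸ-suc (suc i) L = cong tailᴸ (dropᴸ-suc i L)

dropᴸ-zero : ∀ i → dropᴸ i 0 ≡ 0
dropᴸ-zero zero    = refl
dropᴸ-zero (suc i) = cong tailᴸ (dropᴸ-zero i)

dropᴸ-bound′ : ∀ i L {m} → dropᴸ i L ≡ suc m → i + suc m ≤ L
dropᴸ-bound′ zero    L eq = ≤-reflexive (sym eq)
dropᴸ-bound′ (suc i) L {m} eq with dropᴸ i L in eq′
... | suc z = ≤-trans (≤-reflexive (sym (+-suc i (suc m))))
                      (≤-trans (+-monoʳ-≤ i (s≤s (subst (_≤ z) eq (π₂≤ z)))) (dropᴸ-bound′ i L eq′))

dropᴸ-bound : ∀ i L {m} → dropᴸ i L ≡ suc m → i < L
dropᴸ-bound i L {m} eq = ≤-trans (+-monoʳ-≤ 1 (m≤m+n i m)) (subst (_≤ L) (+-suc i m) (dropᴸ-bound′ i L eq))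

∈ᴸ-encodeList : ∀ {e es} → e ∈ es → e ∈ᴸ encodeList es
∈ᴸ-encodeList {e} {.e ∷ t} (here refl) = 0 , pair e (encodeList t) , refl , π₁-pair e (encodeList t)
∈ᴸ-encodeList {e} {h ∷ t}  (there e∈t) with ∈ᴸ-encodeList e∈t
... | i , m , eq , πm = suc i , m , trans (dropᴸ-suc i _) (trans (cong (dropᴸ i) (π₂-pair h (encodeList t))) eq) , πm

encodeList-∈ᴸ : ∀ {e} es → e ∈ᴸ encodeList es → e ∈ es
encodeList-∈ᴸ []      (i , m , eq , _) with trans (sym (dropᴸ-zero i)) eq
... | ()
encodeList-∈ᴸ (h ∷ t) (zero , m , refl , refl) = here (π₁-pair h (encodeList t))
encodeList-∈ᴸ (h ∷ t) (suc i , m , eq , πm) =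
  there (encodeList-∈ᴸ t (i , m , trans (sym (cong (dropᴸ i) (π₂-pair h (encodeList t))))
                                        (trans (sym (dropᴸ-suc i _)) eq) , πm))

at-head : (ℕ → ℕ) → ℕ → ℕ
at-head p z = ifNZ z (p (π₁ (pred z))) 0

any-entry : (ℕ → ℕ) → ℕ → ℕ
any-entry p L = any< (λ i → at-head p (dropᴸ i L)) L

any-entry-sound : ∀ p L → IsTrue (any-entry p L) → ∃ λ e → e ∈ᴸ L × IsTrue (p e)
any-entry-sound p L t with any<-elim _ L t
... | i , _ , pi with dropᴸ i L in eq
... | suc m = π₁ m , (i , m , eq , refl) , pi

any-entry-complete : ∀ p {L e} → e ∈ᴸ L → IsTrue (p e) → IsTrue (any-entry p L)
any-entry-complete p {L} (i , m , eq , refl) pe =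
  any<-intro _ L i (dropᴸ-bound i L eq) (subst (λ z → IsTrue (at-head p z)) (sym eq) pe)

tailᴸᶜ : Computable 1
tailᴸᶜ = resp-≗ (fromTerm (call₃ ifNZᶜ v₀ (call₁ π₂ᶜ (call₁ predᶜ v₀)) (lit 0))) (λ { (z ∷ []) → tailᴸ z })
  (λ { (zero ∷ []) → refl ; (suc z ∷ []) → refl })

dropᴸᶜ : Computable 2
dropᴸᶜ = resp-≗ iterated-tail (λ { (i ∷ L ∷ []) → dropᴸ i L }) (λ { (i ∷ L ∷ []) → iterated-tail-dropᴸ i L })
  where
  iterated-tail : Computable 2
  iterated-tail = natrecᶜ (fromTerm v₀) (fromTerm (call₁ tailᴸᶜ v₁))

  iterated-tail-dropᴸ : ∀ i L → fun iterated-tail (i ∷ L ∷ []) ≡ dropᴸ i L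
  iterated-tail-dropᴸ zero    L = refl
  iterated-tail-dropᴸ (suc i) L = cong tailᴸ (iterated-tail-dropᴸ i L)

any-entryᶜ : Computable 3 → Computable 3
any-entryᶜ P = resp-≗
  (fromTerm (call (any<ᶜ (fromTerm (call₃ ifNZᶜ suffixₜ (call₃ P (call₁ π₁ᶜ (call₁ predᶜ suffixₜ)) v₂ v₃) (lit 0))))
                  (v₀ ∷ v₀ ∷ v₁ ∷ v₂ ∷ [])))
  (λ { (L ∷ a ∷ b ∷ []) → any-entry (λ e → fun P (e ∷ a ∷ b ∷ [])) L })
  (λ { (L ∷ a ∷ b ∷ []) → refl })
  where
  suffixₜ : Term 4
  suffixₜ = call₂ dropᴸᶜ v₀ v₁

-- Certificates
--
-- A certificate is a coded list of entries ⟨⟨c , ⟨x , y⟩⟩ , w⟩, each claiming φ_c(x) = y with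
-- a witness w (the intermediate value of a composition or of a recursion step), and each
-- justified by other entries of the list.  An entry with tag 9, ⟨⟨⟨9 , c⟩ , ⟨0 , 0⟩⟩ , 0⟩,
-- claims instead that c is the number of a code.

fact : ℕ → ℕ → ℕ → ℕ
fact c x y = pair c (pair x y)

key-fact : ∀ k → fact (π₁ k) (π₁ (π₂ k)) (π₂ (π₂ k)) ≡ k
key-fact k = trans (cong (pair (π₁ k)) (pair-π (π₂ k))) (pair-π k)

has-key : ℕ → ℕ → ℕ
has-key L k = any-entry (λ e → eqᵇ (π₁ e) k) L

has-code : ℕ → ℕ → ℕ
has-code L c = any-entry (λ e → eqᵇ (π₁ (π₁ e)) (pair 9 c)) L

positive-key : ℕ → ℕ → ℕ → ℕ
positive-key f x k = andᵇ (eqᵇ (π₁ k) f) (andᵇ (eqᵇ (π₁ (π₂ k)) x) (isZero (isZero (π₂ (π₂ k)))))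

has-positive : ℕ → ℕ → ℕ → ℕ
has-positive L f x = any-entry (λ e → positive-key f x (π₁ e)) L

not-claim : ℕ → ℕ
not-claim c = isZero (eqᵇ (π₁ c) 9)

-- ⟨t , r⟩ is the number of a code whose components L claims to be numbers of codes
claim-check : ℕ → ℕ → ℕ → ℕ
claim-check L t r = ifNZ (t ∸ 4)
  (ifNZ (t ∸ 7) (andᵇ (eqᵇ t 8) (has-code L r)) (andᵇ (has-code L (π₁ r)) (has-code L (π₂ r))))
  (isZero r)

-- the entry ⟨⟨⟨t , r⟩ , ⟨x , y⟩⟩ , w⟩ is justified by the list L, by the rule for the constructor with tag t
valid-step : ℕ → ℕ → ℕ → ℕ → ℕ → ℕ → ℕ
valid-step L 0 r x y w = andᵇ (isZero r) (eqᵇ y 0)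
valid-step L 1 r x y w = andᵇ (isZero r) (eqᵇ y (suc x))
valid-step L 2 r x y w = andᵇ (isZero r) (eqᵇ y x)
valid-step L 3 r x y w = andᵇ (isZero r) (eqᵇ y (π₁ x))
valid-step L 4 r x y w = andᵇ (isZero r) (eqᵇ y (π₂ x))
valid-step L 5 r x y w = andᵇ (not-claim (π₁ r)) (andᵇ (not-claim (π₂ r))
  (andᵇ (has-key L (fact (π₂ r) x w)) (has-key L (fact (π₁ r) w y))))
valid-step L 6 r x y w = andᵇ (not-claim (π₁ r)) (andᵇ (not-claim (π₂ r))
  (andᵇ (has-key L (fact (π₁ r) x (π₁ y))) (has-key L (fact (π₂ r) x (π₂ y)))))
valid-step L 7 r x y w = andᵇ (not-claim (π₁ r)) (andᵇ (not-claim (π₂ r)) (ifNZ (π₂ x)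
  (andᵇ (has-key L (fact (pair 7 r) (pair (π₁ x) (pred (π₂ x))) w))
        (has-key L (fact (π₂ r) (pair (π₁ x) (pair (pred (π₂ x)) w)) y)))
  (andᵇ (has-key L (fact (π₁ r) (π₁ x) y)) (has-code L (π₂ r)))))
valid-step L 8 r x y w = andᵇ (not-claim r)
  (andᵇ (all< (λ m → has-positive L r (pair x m)) y) (has-key L (fact r (pair x y) 0)))
valid-step L 9 r x y w = claim-check L (π₁ r) (π₂ r)
valid-step L _ r x y w = 0

valid-entry : ℕ → ℕ → ℕ
valid-entry L e =
  valid-step L (π₁ (π₁ (π₁ e))) (π₂ (π₁ (π₁ e))) (π₁ (π₂ (π₁ e))) (π₂ (π₂ (π₁ e))) (π₂ e)

all-valid : ℕ → ℕ
all-valid L = isZero (any-entry (λ e → isZero (valid-entry L e)) L)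

valid-entry-fact : ∀ L t r x y w → valid-entry L (pair (fact (pair t r) x y) w) ≡ valid-step L t r x y w
valid-entry-fact L t r x y w
  rewrite π₁-pair (fact (pair t r) x y) w | π₂-pair (fact (pair t r) x y) w
        | π₁-pair (pair t r) (pair x y) | π₂-pair (pair t r) (pair x y)
        | π₁-pair t r | π₂-pair t r | π₁-pair x y | π₂-pair x y = refl

has-key-sound : ∀ L k → IsTrue (has-key L k) → ∃ λ e → e ∈ᴸ L × π₁ e ≡ k
has-key-sound L k t with any-entry-sound _ L t
... | e , e∈L , eq = e , e∈L , eqᵇ-sound _ k eq

has-key-complete : ∀ {L e k} → e ∈ᴸ L → π₁ e ≡ k → IsTrue (has-key L k)
has-key-complete e∈L eq = any-entry-complete _ e∈L (eqᵇ-complete eq)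

has-code-sound : ∀ L c → IsTrue (has-code L c) → ∃ λ e → e ∈ᴸ L × π₁ (π₁ e) ≡ pair 9 c
has-code-sound L c t with any-entry-sound _ L t
... | e , e∈L , eq = e , e∈L , eqᵇ-sound _ _ eq

has-code-complete : ∀ {L e c} → e ∈ᴸ L → π₁ (π₁ e) ≡ pair 9 c → IsTrue (has-code L c)
has-code-complete e∈L eq = any-entry-complete _ e∈L (eqᵇ-complete eq)

positive-key-sound : ∀ f x k → IsTrue (positive-key f x k) → ∃ λ y → k ≡ fact f x (suc y)
positive-key-sound f x k t
  with andᵇ-elim (eqᵇ (π₁ k) f) (andᵇ (eqᵇ (π₁ (π₂ k)) x) (isZero (isZero (π₂ (π₂ k))))) t
... | f≡ , t′ with andᵇ-elim (eqᵇ (π₁ (π₂ k)) x) (isZero (isZero (π₂ (π₂ k)))) t′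
... | x≡ , y>0 with π₂ (π₂ k) in y≡ | isZero-isZero (π₂ (π₂ k)) y>0
... | zero  | ()
... | suc y | _ = y , (begin
  k                                    ≡⟨ sym (pair-π k) ⟩
  pair (π₁ k) (π₂ k)                   ≡⟨ cong (pair (π₁ k)) (sym (pair-π (π₂ k))) ⟩
  fact (π₁ k) (π₁ (π₂ k)) (π₂ (π₂ k)) ≡⟨ cong₂ (λ a b → fact a b (π₂ (π₂ k)))
                                                 (eqᵇ-sound (π₁ k) f f≡) (eqᵇ-sound (π₁ (π₂ k)) x x≡) ⟩
  fact f x (π₂ (π₂ k))                 ≡⟨ cong (fact f x) y≡ ⟩
  fact f x (suc y)                     ∎)
  where open ≡-Reasoning

has-positive-sound : ∀ L f x → IsTrue (has-positive L f x) →
  ∃₂ λ e y → e ∈ᴸ L × π₁ e ≡ fact f x (suc y)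
has-positive-sound L f x t with any-entry-sound (λ e → positive-key f x (π₁ e)) L t
... | e , e∈L , pos = let (y , eq) = positive-key-sound f x (π₁ e) pos in e , y , e∈L , eq

has-positive-complete : ∀ {L e f x k} → e ∈ᴸ L → π₁ e ≡ fact f x (suc k) → IsTrue (has-positive L f x)
has-positive-complete {f = f} {x} {k} e∈L eq =
  any-entry-complete _ e∈L (subst (λ key → IsTrue (positive-key f x key)) (sym eq)
    (andᵇ-intro (eqᵇ-complete (π₁-pair f _))
      (andᵇ-intro (eqᵇ-complete (trans (cong π₁ (π₂-pair f _)) (π₁-pair x _)))
        (subst (λ y → IsTrue (isZero (isZero y))) (sym (trans (cong π₂ (π₂-pair f _)) (π₂-pair x _))) is-true))))

all-valid-sound : ∀ L {e} → IsTrue (all-valid L) → e ∈ᴸ L → IsTrue (valid-entry L e)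
all-valid-sound L {e} t e∈L with valid-entry L e in eq
... | suc _ = is-true
... | zero  = ⊥-elim (IsTrue-isZero (any-entry-complete (λ e → isZero (valid-entry L e)) e∈L
                                      (subst (λ v → IsTrue (isZero v)) (sym eq) is-true)) t)

all-valid-complete : ∀ L → (∀ {e} → e ∈ᴸ L → IsTrue (valid-entry L e)) → IsTrue (all-valid L)
all-valid-complete L valid with any-entry (λ e → isZero (valid-entry L e)) L in eq
... | zero  = is-true
... | suc _ =
  let e , e∈L , invalid = any-entry-sound (λ e → isZero (valid-entry L e)) L (subst IsTrue (sym eq) is-true)
  in ⊥-elim (IsTrue-isZero (valid e∈L) invalid)

has-keyᶜ : Computable 2
has-keyᶜ = resp-≗ (fromTerm (call₃ (any-entryᶜ (fromTerm (call₂ eqᵇᶜ (call₁ π₁ᶜ v₀) v₁))) v₀ v₁ (lit 0)))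
  (λ { (L ∷ k ∷ []) → has-key L k }) (λ { (L ∷ k ∷ []) → refl })

has-codeᶜ : Computable 2
has-codeᶜ = resp-≗
  (fromTerm (call₃ (any-entryᶜ (fromTerm (call₂ eqᵇᶜ (call₁ π₁ᶜ (call₁ π₁ᶜ v₀)) (call₂ pairᶜ (lit 9) v₁))))
                   v₀ v₁ (lit 0)))
  (λ { (L ∷ c ∷ []) → has-code L c }) (λ { (L ∷ c ∷ []) → refl })

has-positiveᶜ : Computable 3
has-positiveᶜ = resp-≗ (any-entryᶜ (fromTerm positive))
  (λ { (L ∷ f ∷ x ∷ []) → has-positive L f x }) (λ { (L ∷ f ∷ x ∷ []) → refl })
  where
  key π₁ₜ π₂ₜ : Term 3 → Term 3
  π₁ₜ = call₁ π₁ᶜ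
  π₂ₜ = call₁ π₂ᶜ
  key e = π₁ₜ e
  positive : Term 3
  positive = call₂ andᵇᶜ (call₂ eqᵇᶜ (π₁ₜ (key v₀)) v₁)
    (call₂ andᵇᶜ (call₂ eqᵇᶜ (π₁ₜ (π₂ₜ (key v₀))) v₂) (call₁ isZeroᶜ (call₁ isZeroᶜ (π₂ₜ (π₂ₜ (key v₀))))))

valid-stepᶜ : Computable 6
valid-stepᶜ = resp-≗ (fromTerm rules)
  (λ { (L ∷ t ∷ r ∷ x ∷ y ∷ w ∷ []) → valid-step L t r x y w })
  (λ { (L ∷ t ∷ r ∷ x ∷ y ∷ w ∷ []) → rules-valid-step L t r x y w })
  where
  L t r x y w : Term 6
  L = v₀
  t = v₁
  r = v₂
  x = v₃
  y = v₄
  w = v₅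

  π₁ₜ π₂ₜ isZeroₜ not-claimₜ : Term 6 → Term 6
  π₁ₜ = call₁ π₁ᶜ
  π₂ₜ = call₁ π₂ᶜ
  isZeroₜ = call₁ isZeroᶜ
  not-claimₜ c = isZeroₜ (call₂ eqᵇᶜ (π₁ₜ c) (lit 9))

  _∧ₜ_ _≡ₜ_ pairₜ has-keyₜ has-codeₜ : Term 6 → Term 6 → Term 6
  _∧ₜ_ = call₂ andᵇᶜ
  _≡ₜ_ = call₂ eqᵇᶜ
  pairₜ = call₂ pairᶜ
  has-keyₜ = call₂ has-keyᶜ
  has-codeₜ = call₂ has-codeᶜ

  ifₜ factₜ : Term 6 → Term 6 → Term 6 → Term 6
  ifₜ = call₃ ifNZᶜ
  factₜ c a b = pairₜ c (pairₜ a b)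

  predₜ : Term 6 → Term 6
  predₜ = call₁ predᶜ

  rule : ℕ → Term 6
  rule 0 = isZeroₜ r ∧ₜ (y ≡ₜ lit 0)
  rule 1 = isZeroₜ r ∧ₜ (y ≡ₜ call₁ sucᶜ x)
  rule 2 = isZeroₜ r ∧ₜ (y ≡ₜ x)
  rule 3 = isZeroₜ r ∧ₜ (y ≡ₜ π₁ₜ x)
  rule 4 = isZeroₜ r ∧ₜ (y ≡ₜ π₂ₜ x)
  rule 5 = not-claimₜ (π₁ₜ r) ∧ₜ (not-claimₜ (π₂ₜ r) ∧ₜ
    (has-keyₜ L (factₜ (π₂ₜ r) x w) ∧ₜ has-keyₜ L (factₜ (π₁ₜ r) w y)))
  rule 6 = not-claimₜ (π₁ₜ r) ∧ₜ (not-claimₜ (π₂ₜ r) ∧ₜ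
    (has-keyₜ L (factₜ (π₁ₜ r) x (π₁ₜ y)) ∧ₜ has-keyₜ L (factₜ (π₂ₜ r) x (π₂ₜ y))))
  rule 7 = not-claimₜ (π₁ₜ r) ∧ₜ (not-claimₜ (π₂ₜ r) ∧ₜ ifₜ (π₂ₜ x)
    (has-keyₜ L (factₜ (pairₜ (lit 7) r) (pairₜ (π₁ₜ x) (predₜ (π₂ₜ x))) w) ∧ₜ
     has-keyₜ L (factₜ (π₂ₜ r) (pairₜ (π₁ₜ x) (pairₜ (predₜ (π₂ₜ x)) w)) y))
    (has-keyₜ L (factₜ (π₁ₜ r) (π₁ₜ x) y) ∧ₜ has-codeₜ L (π₂ₜ r)))
  rule 8 = not-claimₜ r ∧ₜ
    (call (all<ᶜ (fromTerm (call₃ has-positiveᶜ v₁ v₂ (call₂ pairᶜ v₃ v₀)))) (y ∷ L ∷ r ∷ x ∷ []) ∧ₜ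
     has-keyₜ L (factₜ r (pairₜ x y) (lit 0)))
  rule 9 = ifₜ (call₂ ∸ᶜ (π₁ₜ r) (lit 4))
    (ifₜ (call₂ ∸ᶜ (π₁ₜ r) (lit 7)) ((π₁ₜ r ≡ₜ lit 8) ∧ₜ has-codeₜ L (π₂ₜ r))
                                    (has-codeₜ L (π₁ₜ (π₂ₜ r)) ∧ₜ has-codeₜ L (π₂ₜ (π₂ₜ r))))
    (isZeroₜ (π₂ₜ r))
  rule _ = lit 0

  cases : ℕ → ℕ → Term 6
  cases k zero    = lit 0
  cases k (suc n) = ifₜ (t ≡ₜ lit k) (rule k) (cases (suc k) n)

  rules : Term 6
  rules = cases 0 10

  rules-valid-step : ∀ L t r x y w → eval rules (L ∷ t ∷ r ∷ x ∷ y ∷ w ∷ []) ≡ valid-step L t r x y w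
  rules-valid-step L 0 r x y w = refl
  rules-valid-step L 1 r x y w = refl
  rules-valid-step L 2 r x y w = refl
  rules-valid-step L 3 r x y w = refl
  rules-valid-step L 4 r x y w = refl
  rules-valid-step L 5 r x y w = refl
  rules-valid-step L 6 r x y w = refl
  rules-valid-step L 7 r x y w = refl
  rules-valid-step L 8 r x y w = refl
  rules-valid-step L 9 r x y w = refl
  rules-valid-step L (suc (suc (suc (suc (suc (suc (suc (suc (suc (suc t))))))))))  r x y w = refl

valid-entryᶜ : Computable 2
valid-entryᶜ = resp-≗
  (fromTerm (call valid-stepᶜ (v₀ ∷ π₁ₜ (π₁ₜ (π₁ₜ v₁)) ∷ π₂ₜ (π₁ₜ (π₁ₜ v₁)) ∷
                               π₁ₜ (π₂ₜ (π₁ₜ v₁)) ∷ π₂ₜ (π₂ₜ (π₁ₜ v₁)) ∷ π₂ₜ v₁ ∷ [])))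
  (λ { (L ∷ e ∷ []) → valid-entry L e }) (λ { (L ∷ e ∷ []) → refl })
  where
  π₁ₜ π₂ₜ : Term 2 → Term 2
  π₁ₜ = call₁ π₁ᶜ
  π₂ₜ = call₁ π₂ᶜ

all-validᶜ : Computable 1
all-validᶜ = resp-≗
  (fromTerm (call₁ isZeroᶜ (call₃ (any-entryᶜ (fromTerm (call₁ isZeroᶜ (call₂ valid-entryᶜ v₁ v₀)))) v₀ v₀ (lit 0))))
  (λ { (L ∷ []) → all-valid L }) (λ { (L ∷ []) → refl })

-- Soundness of certificates

module Soundness (L : ℕ) (all-valid-L : IsTrue (all-valid L)) where

  valid-step-at : ∀ {e} t r x y → e ∈ᴸ L → π₁ e ≡ fact (pair t r) x y → IsTrue (valid-step L t r x y (π₂ e))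
  valid-step-at {e} t r x y e∈L key =
    subst IsTrue (trans (cong (valid-entry L) (trans (sym (pair-π e)) (cong (λ k → pair k (π₂ e)) key)))
                        (valid-entry-fact L t r x y (π₂ e)))
          (all-valid-sound L all-valid-L e∈L)

  claim-valid : ∀ {c} → IsTrue (has-code L c) → ∃₂ λ x y → ∃ λ w → IsTrue (valid-step L 9 c x y w)
  claim-valid {c} t with has-code-sound L c t
  ... | e , e∈L , claim =
    x , y , π₂ e , valid-step-at 9 c x y e∈L (trans (sym (key-fact (π₁ e))) (cong (λ a → fact a x y) claim))
    where
    x = π₁ (π₂ (π₁ e))
    y = π₂ (π₂ (π₁ e))

  code-sound : ∀ c → Acc _<_ c → IsTrue (has-code L c) → ∃ λ cc → encode cc ≡ c
  code-node : ∀ t r {c} → pair t r ≡ c → Acc _<_ c → IsTrue (claim-check L t r) → ∃ λ cc → encode cc ≡ c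
  code-pair : ∀ t r {c} → pair (suc t) r ≡ c → WfRec _<_ (Acc _<_) c →
    IsTrue (andᵇ (has-code L (π₁ r)) (has-code L (π₂ r))) →
    ∃₂ λ f g → pair (suc t) (pair (encode f) (encode g)) ≡ c

  code-sound c ac t = code-node (π₁ c) (π₂ c) (pair-π c) ac (proj₂ (proj₂ (proj₂ (claim-valid {c} t))))

  code-node 0 r ce _ v rewrite isZero-sound r v = Z  , ce
  code-node 1 r ce _ v rewrite isZero-sound r v = S  , ce
  code-node 2 r ce _ v rewrite isZero-sound r v = I  , ce
  code-node 3 r ce _ v rewrite isZero-sound r v = P₁ , ce
  code-node 4 r ce _ v rewrite isZero-sound r v = P₂ , ce
  code-node 5 r ce (acc rs) v = let f , g , eq = code-pair 4 r ce rs v in comp f g , eq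
  code-node 6 r ce (acc rs) v = let f , g , eq = code-pair 5 r ce rs v in pr f g , eq
  code-node 7 r ce (acc rs) v = let f , g , eq = code-pair 6 r ce rs v in rec f g , eq
  code-node 8 r ce (acc rs) v =
    let f , ef = code-sound r (rs (subst (r <_) ce (b<pair-suc 7 r))) v
    in mu f , trans (cong (pair 8) ef) ce
  code-node (suc (suc (suc (suc (suc (suc (suc (suc (suc _))))))))) r ce _ ()

  code-pair t r ce rs v =
    let hf , hg = andᵇ-elim (has-code L (π₁ r)) (has-code L (π₂ r)) v
        f , ef = code-sound (π₁ r) (rs (subst (π₁ r <_) ce (π₁<pair-suc t r))) hf
        g , eg = code-sound (π₂ r) (rs (subst (π₂ r <_) ce (π₂<pair-suc t r))) hg
    in f , g , trans (encode-node (suc t) r f g ef eg) ce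

  Recorded : ℕ → ℕ → ℕ → Set
  Recorded c x y = IsTrue (has-key L (fact c x y)) → IsTrue (not-claim c) → c ⟪ x ⟫⇓ y

  step-sound : ∀ t r {x y w} → (∀ {c} → c < pair t r → ∀ x′ y′ → Recorded c x′ y′) →
    (∀ {x′} → x′ < x → ∀ y′ → IsTrue (has-key L (fact (pair t r) x′ y′)) → pair t r ⟪ x′ ⟫⇓ y′) →
    ¬ t ≡ 9 → IsTrue (valid-step L t r x y w) → pair t r ⟪ x ⟫⇓ y
  step-sound 0 r {x} {y} _ _ _ v =
    let r0 , y≡ = andᵇ-elim (isZero r) (eqᵇ y 0) v
    in ⟪⟫-basic 0 r Z refl (isZero-sound r r0) (subst (Z ∙ x ⇓_) (sym (eqᵇ-sound y 0 y≡)) zeroE)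
  step-sound 1 r {x} {y} _ _ _ v =
    let r0 , y≡ = andᵇ-elim (isZero r) (eqᵇ y (suc x)) v
    in ⟪⟫-basic 1 r S refl (isZero-sound r r0) (subst (S ∙ x ⇓_) (sym (eqᵇ-sound y (suc x) y≡)) succE)
  step-sound 2 r {x} {y} _ _ _ v =
    let r0 , y≡ = andᵇ-elim (isZero r) (eqᵇ y x) v
    in ⟪⟫-basic 2 r I refl (isZero-sound r r0) (subst (I ∙ x ⇓_) (sym (eqᵇ-sound y x y≡)) idE)
  step-sound 3 r {x} {y} _ _ _ v =
    let r0 , y≡ = andᵇ-elim (isZero r) (eqᵇ y (π₁ x)) v
    in ⟪⟫-basic 3 r P₁ refl (isZero-sound r r0) (subst (P₁ ∙ x ⇓_) (sym (eqᵇ-sound y (π₁ x) y≡)) (P₁-⇓ x))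
  step-sound 4 r {x} {y} _ _ _ v =
    let r0 , y≡ = andᵇ-elim (isZero r) (eqᵇ y (π₂ x)) v
    in ⟪⟫-basic 4 r P₂ refl (isZero-sound r r0) (subst (P₂ ∙ x ⇓_) (sym (eqᵇ-sound y (π₂ x) y≡)) (P₂-⇓ x))
  step-sound 5 r {x} {y} {w} sub-code _ _ v =
    let nf , ng , hg , hf = and₄ (not-claim (π₁ r)) (not-claim (π₂ r))
                                 (has-key L (fact (π₂ r) x w)) (has-key L (fact (π₁ r) w y)) v
    in ⟪⟫-comp r (sub-code (π₂<pair-suc 4 r) x w hg ng) (sub-code (π₁<pair-suc 4 r) w y hf nf)
  step-sound 6 r {x} {y} sub-code _ _ v =
    let nf , ng , hf , hg = and₄ (not-claim (π₁ r)) (not-claim (π₂ r))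
                                 (has-key L (fact (π₁ r) x (π₁ y))) (has-key L (fact (π₂ r) x (π₂ y))) v
    in subst (pair 6 r ⟪ x ⟫⇓_) (pair-π y)
         (⟪⟫-pr r (sub-code (π₁<pair-suc 5 r) x (π₁ y) hf nf) (sub-code (π₂<pair-suc 5 r) x (π₂ y) hg ng))
  step-sound 7 r {x} {y} {w} sub-code sub-input _ v =
    let nf , ng , by-cases = and₃ (not-claim (π₁ r)) (not-claim (π₂ r)) (branch (π₂ x)) v
    in subst (pair 7 r ⟪_⟫⇓ y) (pair-π x) (by-input (π₂ x) refl nf ng by-cases)
    where
    branch : ℕ → ℕ
    branch n = ifNZ n
      (andᵇ (has-key L (fact (pair 7 r) (pair (π₁ x) (pred n)) w))
            (has-key L (fact (π₂ r) (pair (π₁ x) (pair (pred n) w)) y)))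
      (andᵇ (has-key L (fact (π₁ r) (π₁ x) y)) (has-code L (π₂ r)))

    by-input : ∀ n → π₂ x ≡ n → IsTrue (not-claim (π₁ r)) → IsTrue (not-claim (π₂ r)) → IsTrue (branch n) →
      pair 7 r ⟪ pair (π₁ x) n ⟫⇓ y
    by-input zero _ nf _ b =
      let hf , hg = andᵇ-elim (has-key L (fact (π₁ r) (π₁ x) y)) (has-code L (π₂ r)) b
      in ⟪⟫-rec-zero r (sub-code (π₁<pair-suc 6 r) (π₁ x) y hf nf) (code-sound (π₂ r) (<-wellFounded _) hg)
    by-input (suc n) eq _ ng b =
      let hc , hg = andᵇ-elim (has-key L (fact (pair 7 r) (pair (π₁ x) n) w))
                              (has-key L (fact (π₂ r) (pair (π₁ x) (pair n w)) y)) b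
      in ⟪⟫-rec-suc r {π₁ x} {n} (sub-input x′<x w hc)
                                 (sub-code (π₂<pair-suc 6 r) (pair (π₁ x) (pair n w)) y hg ng)
      where
      x′<x : pair (π₁ x) n < x
      x′<x = subst (pair (π₁ x) n <_) (trans (cong (pair (π₁ x)) (sym eq)) (pair-π x)) (pair<pair-suc (π₁ x) n)
  step-sound 8 r {x} {y} sub-code _ _ v =
    let nf , below , hf = and₃ (not-claim r) (all< (λ m → has-positive L r (pair x m)) y)
                               (has-key L (fact r (pair x y) 0)) v
    in ⟪⟫-mu r (sub-code (b<pair-suc 7 r) (pair x y) 0 hf nf) λ m m<y →
         let e , k , e∈L , key = has-positive-sound L r (pair x m) (all<-elim _ y below m m<y)
         in k , sub-code (b<pair-suc 7 r) (pair x m) (suc k) (has-key-complete e∈L key) nf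
  step-sound 9 r _ _ t≢9 _ = ⊥-elim (t≢9 refl)
  step-sound (suc (suc (suc (suc (suc (suc (suc (suc (suc (suc _)))))))))) r _ _ _ ()

  runs-sound : ∀ c → Acc _<_ c → ∀ x → Acc _<_ x → ∀ y → Recorded c x y
  runs-sound c ac@(acc rc) x (acc rx) y hk nc =
    let e , e∈L , key = has-key-sound L (fact c x y) hk

        smaller-code : ∀ {c′} → c′ < pair (π₁ c) (π₂ c) → ∀ x′ y′ → Recorded c′ x′ y′
        smaller-code lt x′ y′ = runs-sound _ (rc (subst (_ <_) (pair-π c) lt)) x′ (<-wellFounded x′) y′

        smaller-input : ∀ {x′} → x′ < x → ∀ y′ → IsTrue (has-key L (fact (pair (π₁ c) (π₂ c)) x′ y′)) →
          pair (π₁ c) (π₂ c) ⟪ x′ ⟫⇓ y′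
        smaller-input {x′} lt y′ hk′ = subst (λ c → c ⟪ x′ ⟫⇓ y′) (sym (pair-π c))
          (runs-sound c ac x′ (rx lt) y′ (subst (λ c → IsTrue (has-key L (fact c x′ y′))) (pair-π c) hk′) nc)
    in subst (λ c → c ⟪ x ⟫⇓ y) (pair-π c)
         (step-sound (π₁ c) (π₂ c) smaller-code smaller-input (≢ᵇ-sound (π₁ c) 9 nc)
                     (valid-step-at (π₁ c) (π₂ c) x y e∈L (trans key (cong (λ c → fact c x y) (sym (pair-π c))))))

  recorded-sound : ∀ c x y → Recorded c x y
  recorded-sound c x y = runs-sound c (<-wellFounded c) x (<-wellFounded x) y

-- Completeness of certificates

-- certificates are combined by concatenation, so validity is asked for in every list containing them
Closed : ℕ → List ℕ → Set
Closed e es = ∀ L → (∀ {e′} → e′ ∈ e ∷ es → e′ ∈ᴸ L) → ∀ {e′} → e′ ∈ e ∷ es → IsTrue (valid-entry L e′)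

record Certificate (k : ℕ) : Set where
  constructor certificate
  field
    witness : ℕ
    entries : List ℕ
    closed  : Closed (pair k witness) entries
open Certificate public

Certified : Set
Certified = Σ ℕ Certificate

head-entry : Certified → ℕ
head-entry (k , C) = pair k (witness C)

all-entries : Certified → List ℕ
all-entries (k , C) = head-entry (k , C) ∷ entries C

Includes : List Certified → ℕ → Set
Includes ps L = ∀ {p} → p ∈ ps → head-entry p ∈ᴸ L

certify : ∀ k w (ps : List Certified) → (∀ L → Includes ps L → IsTrue (valid-entry L (pair k w))) → Certificate k
certify k w ps valid-head = certificate w (concatMap all-entries ps) closed-list
  where
  from-premise : ∀ {p e} → p ∈ ps → e ∈ all-entries p → e ∈ pair k w ∷ concatMap all-entries ps
  from-premise p∈ps e∈p = there (∈-concatMap⁺ all-entries (lose p∈ps e∈p))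

  closed-list : Closed (pair k w) (concatMap all-entries ps)
  closed-list L inc (here refl) = valid-head L (λ p∈ps → inc (from-premise p∈ps (here refl)))
  closed-list L inc (there e∈) =
    let p , p∈ps , e∈p = find (∈-concatMap⁻ all-entries e∈)
    in closed (proj₂ p) L (λ e′∈p → inc (from-premise p∈ps e′∈p)) e∈p

certify-step : ∀ t r x y w (ps : List Certified) → (∀ L → Includes ps L → IsTrue (valid-step L t r x y w)) →
  Certificate (fact (pair t r) x y)
certify-step t r x y w ps valid =
  certify _ w ps (λ L inc → subst IsTrue (sym (valid-entry-fact L t r x y w)) (valid L inc))

module _ {ps : List Certified} {L : ℕ} (inc : Includes ps L) where

  recorded : ∀ {k} {C : Certificate k} → (k , C) ∈ ps → IsTrue (has-key L k)
  recorded p∈ = has-key-complete (inc p∈) (π₁-pair _ _)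

  recorded-code : ∀ c {C : Certificate (fact (pair 9 c) 0 0)} → (_ , C) ∈ ps → IsTrue (has-code L c)
  recorded-code c {C} p∈ =
    has-code-complete {c = c} (inc p∈)
      (trans (cong π₁ (π₁-pair (fact (pair 9 c) 0 0) (witness C))) (π₁-pair (pair 9 c) (pair 0 0)))

  recorded-positive : ∀ {f x k} {C : Certificate (fact f x (suc k))} → (_ , C) ∈ ps → IsTrue (has-positive L f x)
  recorded-positive p∈ = has-positive-complete (inc p∈) (π₁-pair _ _)

not-claim-encode : ∀ f → IsTrue (not-claim (encode f))
not-claim-encode f = subst (λ t → IsTrue (isZero (eqᵇ t 9))) (sym (π₁-encode f)) (tag-not-9 f)
  where
  tag-not-9 : ∀ f → IsTrue (isZero (eqᵇ (tag f) 9))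
  tag-not-9 Z          = is-true
  tag-not-9 S          = is-true
  tag-not-9 I          = is-true
  tag-not-9 P₁         = is-true
  tag-not-9 P₂         = is-true
  tag-not-9 (comp _ _) = is-true
  tag-not-9 (pr _ _)   = is-true
  tag-not-9 (rec _ _)  = is-true
  tag-not-9 (mu _)     = is-true

valid-comp : ∀ L f g {x w y} →
  IsTrue (has-key L (fact (encode g) x w)) → IsTrue (has-key L (fact (encode f) w y)) →
  IsTrue (valid-step L 5 (pair (encode f) (encode g)) x y w)
valid-comp L f g hg hf rewrite π₁-pair (encode f) (encode g) | π₂-pair (encode f) (encode g) =
  andᵇ-intro (not-claim-encode f) (andᵇ-intro (not-claim-encode g) (andᵇ-intro hg hf))

valid-pr : ∀ L f g {x y₁ y₂ w} →
  IsTrue (has-key L (fact (encode f) x y₁)) → IsTrue (has-key L (fact (encode g) x y₂)) →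
  IsTrue (valid-step L 6 (pair (encode f) (encode g)) x (pair y₁ y₂) w)
valid-pr L f g {y₁ = y₁} {y₂} hf hg
  rewrite π₁-pair (encode f) (encode g) | π₂-pair (encode f) (encode g) | π₁-pair y₁ y₂ | π₂-pair y₁ y₂ =
  andᵇ-intro (not-claim-encode f) (andᵇ-intro (not-claim-encode g) (andᵇ-intro hf hg))

valid-rec-zero : ∀ L f g {x y w} → IsTrue (has-key L (fact (encode f) x y)) → IsTrue (has-code L (encode g)) →
  IsTrue (valid-step L 7 (pair (encode f) (encode g)) (pair x 0) y w)
valid-rec-zero L f g {x} hf hg
  rewrite π₁-pair (encode f) (encode g) | π₂-pair (encode f) (encode g) | π₁-pair x 0 | π₂-pair x 0 =
  andᵇ-intro (not-claim-encode f) (andᵇ-intro (not-claim-encode g) (andᵇ-intro hf hg))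

valid-rec-suc : ∀ L f g {x n y z} → IsTrue (has-key L (fact (encode (rec f g)) (pair x n) y)) →
  IsTrue (has-key L (fact (encode g) (pair x (pair n y)) z)) →
  IsTrue (valid-step L 7 (pair (encode f) (encode g)) (pair x (suc n)) z y)
valid-rec-suc L f g {x} {n} hr hg
  rewrite π₁-pair (encode f) (encode g) | π₂-pair (encode f) (encode g) | π₁-pair x (suc n) | π₂-pair x (suc n) =
  andᵇ-intro (not-claim-encode f) (andᵇ-intro (not-claim-encode g) (andᵇ-intro hr hg))

valid-mu : ∀ L f {x n w} → (∀ m → m < n → IsTrue (has-positive L (encode f) (pair x m))) →
  IsTrue (has-key L (fact (encode f) (pair x n) 0)) → IsTrue (valid-step L 8 (encode f) x n w)
valid-mu L f {n = n} below hf = andᵇ-intro (not-claim-encode f) (andᵇ-intro (all<-intro _ n below) hf)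

valid-claim : ∀ L t r → IsTrue (claim-check L t r) → IsTrue (valid-step L 9 (pair t r) 0 0 0)
valid-claim L t r v rewrite π₁-pair t r | π₂-pair t r = v

has-code-components : ∀ L f g → IsTrue (has-code L (encode f)) → IsTrue (has-code L (encode g)) →
  IsTrue (andᵇ (has-code L (π₁ (pair (encode f) (encode g)))) (has-code L (π₂ (pair (encode f) (encode g)))))
has-code-components L f g hf hg rewrite π₁-pair (encode f) (encode g) | π₂-pair (encode f) (encode g) =
  andᵇ-intro hf hg

code-certificate : ∀ f → Certificate (fact (pair 9 (encode f)) 0 0)
code-certificate Z  = certify-step 9 (encode Z)  0 0 0 [] (λ _ _ → is-true)
code-certificate S  = certify-step 9 (encode S)  0 0 0 [] (λ _ _ → is-true)
code-certificate I  = certify-step 9 (encode I)  0 0 0 [] (λ _ _ → is-true)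
code-certificate P₁ = certify-step 9 (encode P₁) 0 0 0 [] (λ _ _ → is-true)
code-certificate P₂ = certify-step 9 (encode P₂) 0 0 0 [] (λ _ _ → is-true)
code-certificate (comp f g) = certify-step 9 (encode (comp f g)) 0 0 0
  ((_ , code-certificate f) ∷ (_ , code-certificate g) ∷ [])
  (λ L inc → valid-claim L 5 (pair (encode f) (encode g)) (has-code-components L f g
               (recorded-code inc (encode f) (here refl)) (recorded-code inc (encode g) (there (here refl)))))
code-certificate (pr f g) = certify-step 9 (encode (pr f g)) 0 0 0
  ((_ , code-certificate f) ∷ (_ , code-certificate g) ∷ [])
  (λ L inc → valid-claim L 6 (pair (encode f) (encode g)) (has-code-components L f g
               (recorded-code inc (encode f) (here refl)) (recorded-code inc (encode g) (there (here refl)))))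
code-certificate (rec f g) = certify-step 9 (encode (rec f g)) 0 0 0
  ((_ , code-certificate f) ∷ (_ , code-certificate g) ∷ [])
  (λ L inc → valid-claim L 7 (pair (encode f) (encode g)) (has-code-components L f g
               (recorded-code inc (encode f) (here refl)) (recorded-code inc (encode g) (there (here refl)))))
code-certificate (mu f) = certify-step 9 (encode (mu f)) 0 0 0
  ((_ , code-certificate f) ∷ [])
  (λ L inc → valid-claim L 8 (encode f) (recorded-code inc (encode f) (here refl)))

certificate-of : ∀ {c x y} → c ∙ x ⇓ y → Certificate (fact (encode c) x y)
certificate-positive : ∀ {c x} → (∃ λ k → c ∙ x ⇓ suc k) → ∃ λ k → Certificate (fact (encode c) x (suc k))

certificate-positive (k , d) = k , certificate-of d

certificate-of (zeroE {x})     = certify-step 0 0 x 0 0 [] (λ _ _ → is-true)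
certificate-of (succE {x})     = certify-step 1 0 x (suc x) 0 [] (λ _ _ → eqᵇ-complete {suc x} refl)
certificate-of (idE {x})       = certify-step 2 0 x x 0 [] (λ _ _ → eqᵇ-complete {x} refl)
certificate-of (fstE {a} {b})  = certify-step 3 0 (pair a b) a 0 [] (λ _ _ → eqᵇ-complete (sym (π₁-pair a b)))
certificate-of (sndE {a} {b})  = certify-step 4 0 (pair a b) b 0 [] (λ _ _ → eqᵇ-complete (sym (π₂-pair a b)))
certificate-of (compE {f} {g} {x} {y} {z} dg df) =
  certify-step 5 (pair (encode f) (encode g)) x z y
    ((fact (encode g) x y , certificate-of dg) ∷ (fact (encode f) y z , certificate-of df) ∷ [])
    (λ L inc → valid-comp L f g {x} {y} {z} (recorded inc (here refl)) (recorded inc (there (here refl))))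
certificate-of (prE {f} {g} {x} {y₁} {y₂} df dg) =
  certify-step 6 (pair (encode f) (encode g)) x (pair y₁ y₂) 0
    ((fact (encode f) x y₁ , certificate-of df) ∷ (fact (encode g) x y₂ , certificate-of dg) ∷ [])
    (λ L inc → valid-pr L f g {x} {y₁} {y₂} {0} (recorded inc (here refl)) (recorded inc (there (here refl))))
certificate-of (recZ {f} {g} {x} {y} df) =
  certify-step 7 (pair (encode f) (encode g)) (pair x 0) y 0
    ((fact (encode f) x y , certificate-of df) ∷ (_ , code-certificate g) ∷ [])
    (λ L inc → valid-rec-zero L f g {x} {y} (recorded inc (here refl))
                                            (recorded-code inc (encode g) (there (here refl))))
certificate-of (recS {f} {g} {x} {n} {y} {z} d₁ d₂) =
  certify-step 7 (pair (encode f) (encode g)) (pair x (suc n)) z y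
    ((fact (encode (rec f g)) (pair x n) y , certificate-of d₁) ∷
     (fact (encode g) (pair x (pair n y)) z , certificate-of d₂) ∷ [])
    (λ L inc → valid-rec-suc L f g {x} {n} {y} {z} (recorded inc (here refl)) (recorded inc (there (here refl))))
certificate-of (muE {f} {x} {n} d h) =
  certify-step 8 (encode f) x n 0 ((fact (encode f) (pair x n) 0 , certificate-of d) ∷ tabulate below)
    (λ L inc → valid-mu L f {x} {n} {0} (positive-below L (λ p∈ → inc (there p∈))) (recorded inc (here refl)))
  where
  below : Fin n → Certified
  below i = let k , C = certificate-positive (h (toℕ i) (toℕ<n i))
            in fact (encode f) (pair x (toℕ i)) (suc k) , C

  positive-below : ∀ L → Includes (tabulate below) L → ∀ m → m < n → IsTrue (has-positive L (encode f) (pair x m))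
  positive-below L inc m m<n = subst (λ m → IsTrue (has-positive L (encode f) (pair x m))) (toℕ-fromℕ< m<n)
                                     (recorded-positive inc (∈-tabulate⁺ (fromℕ< m<n)))

-- The union of W u and W i, uniformly in i

-- An opaque identity, which keeps the type checker from computing the astronomically large
-- numbers of concrete codes.
opaque
  blocked : ℕ → ℕ
  blocked n = n

  blocked-≡ : ∀ n → blocked n ≡ n
  blocked-≡ n = refl

blocked-encode-comp : ∀ f g → blocked (encode (comp f g)) ≡ pair 5 (pair (blocked (encode f)) (encode g))
blocked-encode-comp f g =
  trans (blocked-≡ (encode (comp f g))) (cong (λ a → pair 5 (pair a (encode g))) (sym (blocked-≡ (encode f))))

module Union (u : ℕ) where

  -- the entry e records a value of φ_c(x) for c = i or c = u
  witnesses : ℕ → ℕ → ℕ → ℕ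
  witnesses e i x = andᵇ (orᵇ (eqᵇ (π₁ (π₁ e)) i) (eqᵇ (π₁ (π₁ e)) u))
                         (andᵇ (eqᵇ (π₁ (π₂ (π₁ e))) x) (not-claim (π₁ (π₁ e))))

  certifies : ℕ → ℕ → ℕ → ℕ
  certifies i x L = andᵇ (all-valid L) (any-entry (λ e → witnesses e i x) L)

  rejectsᶜ : Computable 2
  rejectsᶜ = resp-≗
    (fromTerm (call₁ isZeroᶜ (call₂ andᵇᶜ (call₁ all-validᶜ v₁)
                                         (call₃ (any-entryᶜ (fromTerm witnessesₜ)) v₁ (call₁ π₁ᶜ v₀) (call₁ π₂ᶜ v₀)))))
    (λ { (z ∷ L ∷ []) → isZero (certifies (π₁ z) (π₂ z) L) }) (λ { (z ∷ L ∷ []) → refl })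
    where
    cₜ : Term 3
    cₜ = call₁ π₁ᶜ (call₁ π₁ᶜ v₀)
    witnessesₜ : Term 3
    witnessesₜ = call₂ andᵇᶜ (call₂ orᵇᶜ (call₂ eqᵇᶜ cₜ v₁) (call₂ eqᵇᶜ cₜ (lit u)))
      (call₂ andᵇᶜ (call₂ eqᵇᶜ (call₁ π₁ᶜ (call₁ π₂ᶜ (call₁ π₁ᶜ v₀))) v₂)
                   (call₁ isZeroᶜ (call₂ eqᵇᶜ (call₁ π₁ᶜ cₜ) (lit 9))))

  search-code : Code
  search-code = comp (code rejectsᶜ) (pr P₁ (pr P₂ Z))

  search-code-⇓ : ∀ i x L → search-code ∙ pair (pair i x) L ⇓ isZero (certifies i x L)
  search-code-⇓ i x L =
    compE (prE (fstE {pair i x} {L}) (prE (sndE {pair i x} {L}) zeroE))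
          (subst (code rejectsᶜ ∙ pair (pair i x) (pair L 0) ⇓_)
                 (cong₂ (λ a b → isZero (certifies a b L)) (π₁-pair i x) (π₂-pair i x))
                 (computes rejectsᶜ (pair i x ∷ L ∷ [])))

  union-code : Code
  union-code = mu search-code

  witnessed-sound : ∀ {L e i x} → IsTrue (all-valid L) → e ∈ᴸ L → IsTrue (witnesses e i x) → W i x ⊎ W u x
  witnessed-sound {L} {e} {i} {x} valid e∈L w =
    let c-is , x≡ , nc = and₃ (orᵇ (eqᵇ c i) (eqᵇ c u)) (eqᵇ (π₁ (π₂ (π₁ e))) x) (not-claim c) w
        key = trans (sym (key-fact (π₁ e))) (cong (λ a → fact c a y) (eqᵇ-sound (π₁ (π₂ (π₁ e))) x x≡))
        runs = Soundness.recorded-sound L valid c x y (has-key-complete e∈L key) nc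
    in [ (λ c≡i → inj₁ (y , subst (λ c → c ⟪ x ⟫⇓ y) (eqᵇ-sound c i c≡i) runs))
       , (λ c≡u → inj₂ (y , subst (λ c → c ⟪ x ⟫⇓ y) (eqᵇ-sound c u c≡u) runs)) ]′
       (orᵇ-elim (eqᵇ c i) (eqᵇ c u) c-is)
    where
    c = π₁ (π₁ e)
    y = π₂ (π₂ (π₁ e))

  union-sound : ∀ i x n → union-code ∙ pair i x ⇓ n → W i x ⊎ W u x
  union-sound i x n (muE d _) =
    let found = isZero-false (certifies i x n) (sym (⇓-deterministic d (search-code-⇓ i x n)))
        valid , witnessed = andᵇ-elim (all-valid n) (any-entry (λ e → witnesses e i x) n) found
        e , e∈L , w = any-entry-sound (λ e → witnesses e i x) n witnessed
    in witnessed-sound valid e∈L w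

  witnesses-fact : ∀ c x y w i →
    witnesses (pair (fact c x y) w) i x ≡ andᵇ (orᵇ (eqᵇ c i) (eqᵇ c u)) (andᵇ (eqᵇ x x) (not-claim c))
  witnesses-fact c x y w i
    rewrite π₁-pair (fact c x y) w | π₁-pair c (pair x y) | π₂-pair c (pair x y) | π₁-pair x y = refl

  union-complete-at : ∀ i x c → IsTrue (orᵇ (eqᵇ c i) (eqᵇ c u)) → W c x → ∃ λ n → union-code ∙ pair i x ⇓ n
  union-complete-at i x c c-is (y , f , refl , d) =
    let C = certificate-of d
        es = all-entries (_ , C)
        valid = all-valid-complete (encodeList es)
                  (λ e∈L → closed C (encodeList es) ∈ᴸ-encodeList (encodeList-∈ᴸ es e∈L))
        w = subst IsTrue (sym (witnesses-fact (encode f) x y (witness C) i))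
                  (andᵇ-intro c-is (andᵇ-intro (eqᵇ-complete {x} refl) (not-claim-encode f)))
        found = andᵇ-intro valid (any-entry-complete (λ e → witnesses e i x) (∈ᴸ-encodeList {es = es} (here refl)) w)
        n , certifies-n , before = least-true (certifies i x) (encodeList es) found
    in n , muE (subst (search-code ∙ pair (pair i x) n ⇓_) (isZero-true certifies-n) (search-code-⇓ i x n))
               (λ m m<n → 0 , subst (search-code ∙ pair (pair i x) m ⇓_) (cong isZero (before m m<n))
                                    (search-code-⇓ i x m))

  union-complete : ∀ i x → W i x ⊎ W u x → ∃ λ n → union-code ∙ pair i x ⇓ n
  union-complete i x (inj₁ wi) = union-complete-at i x i (orᵇ-introˡ (eqᵇ i u) (eqᵇ-complete {i} refl)) wi
  union-complete i x (inj₂ wu) = union-complete-at i x u (orᵇ-introʳ (eqᵇ u i) (eqᵇ-complete {u} refl)) wu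

  union-index : ℕ → ℕ
  union-index i = blocked (encode (comp union-code (pr (const-code i) I)))

  W-union-index : ∀ i x → W (union-index i) x → W i x ⊎ W u x
  W-union-index i x (y , c , ec , d) =
    from-comp (subst (λ c → c ∙ x ⇓ y) (encode-injective c (comp union-code (pr (const-code i) I))
                                          (trans ec (blocked-≡ (encode (comp union-code (pr (const-code i) I)))))) d)
    where
    from-comp : comp union-code (pr (const-code i) I) ∙ x ⇓ y → W i x ⊎ W u x
    from-comp (compE (prE da idE) d) =
      union-sound i x y (subst (λ a → union-code ∙ pair a x ⇓ y) (⇓-deterministic da (const-code-⇓ i x)) d)

  union-index-W : ∀ i x → W i x ⊎ W u x → W (union-index i) x
  union-index-W i x w =
    let n , d = union-complete i x w
    in n , comp union-code (pr (const-code i) I) , sym (blocked-≡ (encode (comp union-code (pr (const-code i) I)))) ,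
       compE (prE (const-code-⇓ i x) idE) d

  union-indexᶜ : Computable 1
  union-indexᶜ = resp-≗
    (fromTerm (pairₜ (lit 5) (pairₜ (lit (blocked (encode union-code)))
                                    (pairₜ (lit 6) (pairₜ (call₁ encode-constᶜ v₀) (lit (encode I)))))))
    (λ { (i ∷ []) → union-index i })
    (λ { (i ∷ []) → sym (blocked-encode-comp union-code (pr (const-code i) I)) })
    where
    pairₜ : Term 1 → Term 1 → Term 1
    pairₜ = call₂ pairᶜ

    encode-constᶜ : Computable 1
    encode-constᶜ = resp-≗ (natrecᶜ (constant 0) (fromTerm (call₂ pairᶜ (lit 5) (call₂ pairᶜ (lit (encode S)) v₁))))
      (λ { (i ∷ []) → encode (const-code i) }) (λ { (i ∷ []) → natrec-encode i })
      where
      natrec-encode : ∀ i → fun (natrecᶜ (constant 0) (fromTerm (call₂ pairᶜ (lit 5) (call₂ pairᶜ (lit (encode S)) v₁)))) (i ∷ [])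
                            ≡ encode (const-code i)
      natrec-encode zero    = refl
      natrec-encode (suc i) = cong (λ e → pair 5 (pair (encode S) e)) (natrec-encode i)

opaque
  _∘ᵢ_ : ℕ → Code → ℕ
  e ∘ᵢ g = pair 5 (pair e (blocked (encode g)))

  ∘ᵢ-⇓ : ∀ {e g x x′ v} → g ∙ x ⇓ x′ → e ⟪ x′ ⟫⇓ v → (e ∘ᵢ g) ⟪ x ⟫⇓ v
  ∘ᵢ-⇓ {g = g} dg (c , ec , dc) =
    comp c g , cong₂ (λ a b → pair 5 (pair a b)) ec (sym (blocked-≡ (encode g))) , compE dg dc

module _ (L : Logic) where
  open Logic L

  consistent-below : ∀ {Γ Δ} → (∀ {φ} → Γ φ → Δ ⊢ φ) → Consistent L Δ → Consistent L Γ
  consistent-below Γ⊆Δ (φ , Δ⊬φ) = φ , λ Γ⊢φ → Δ⊬φ (cut Γ⊆Δ Γ⊢φ)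

  consistent-∪ : ∀ {U A K} → Consistent L K → Extends L K U → Subtheory L A K → Consistent L (U ∪ A)
  consistent-∪ {U} {A} {K} cons extends sub = consistent-below sub∪ cons
    where
    sub∪ : ∀ {φ} → (U ∪ A) φ → K ⊢ φ
    sub∪ {φ} (inj₁ uφ) = extends φ (ax uφ)
    sub∪ {φ} (inj₂ aφ) = sub φ aφ

  module _ {U A K : Pred} (K⊆ : ∀ {φ} → K φ → (U ∪ A) φ) (⊆K : ∀ {φ} → (U ∪ A) φ → K φ) where

    ∪-consistent : Consistent L (U ∪ A) → Consistent L K
    ∪-consistent = consistent-below (λ Kφ → ax (K⊆ Kφ))

    ∪-extends : Extends L K U
    ∪-extends φ U⊢φ = cut (λ Uψ → ax (⊆K (inj₁ Uψ))) U⊢φ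

    ∪-subtheory : Subtheory L A K
    ∪-subtheory φ Aφ = ax (⊆K (inj₂ Aφ))

  creative⇒condition-ii : ∀ u X → EffEssHerCreative L (W u) X → ConditionII L (W u) X
  creative⇒condition-ii u X (e , Φ-works) = e ∘ᵢ add-union-index , λ i j cons disjoint →
    let v , Φ⇓v , rest = Φ-works i j (union-index i) (∪-consistent (K⊆ i) (⊆K i) cons)
                                 (∪-extends (K⊆ i) (⊆K i)) (∪-subtheory (K⊆ i) (⊆K i)) disjoint
    in v , ∘ᵢ-⇓ (add-union-index-⇓ i j) Φ⇓v , rest
    where
    open Union u

    K⊆ : ∀ i {φ} → W (union-index i) φ → (W u ∪ W i) φ
    K⊆ i {φ} wk = swap (W-union-index i φ wk)

    ⊆K : ∀ i {φ} → (W u ∪ W i) φ → W (union-index i) φ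
    ⊆K i {φ} w = union-index-W i φ (swap w)

    add-union-index : Code
    add-union-index = pr P₁ (pr P₂ (comp (code union-indexᶜ) (pr P₁ Z)))

    add-union-index-⇓ : ∀ i j → add-union-index ∙ pair i j ⇓ pair i (pair j (union-index i))
    add-union-index-⇓ i j =
      prE (fstE {i} {j}) (prE (sndE {i} {j}) (compE (prE (fstE {i} {j}) zeroE) (computes union-indexᶜ (i ∷ []))))

  condition-ii⇒creative : ∀ u X → ConditionII L (W u) X → EffEssHerCreative L (W u) X
  condition-ii⇒creative u X (e , Ψ-works) = e ∘ᵢ drop-last , λ i j k cons extends sub disjoint →
    let v , Ψ⇓v , rest = Ψ-works i j (consistent-∪ cons extends sub) disjoint
    in v , ∘ᵢ-⇓ (drop-last-⇓ i j k) Ψ⇓v , rest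
    where
    drop-last : Code
    drop-last = pr P₁ (comp P₁ P₂)

    drop-last-⇓ : ∀ i j k → drop-last ∙ pair i (pair j k) ⇓ pair i j
    drop-last-⇓ i j k = prE (fstE {i} {pair j k}) (compE (sndE {i} {pair j k}) (fstE {j} {k}))

lemma5p2 : (L : Logic) (u : ℕ) (X : Pred) →
    Consistent L (W u) →
    (EffEssHerCreative L (W u) X → ConditionII L (W u) X) ×
    (ConditionII L (W u) X → EffEssHerCreative L (W u) X)
lemma5p2 L u X _ = creative⇒condition-ii L u X , condition-ii⇒creative L u X
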